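{- Let $q$ be a prime power and $n\ge1$. A subset $\mathcal{U}\subseteq\mathbb{P}_q(n)$ is a distributive sublattice of the linear lattice $(\mathbb{P}_q(n),+,\cap)$ on which a complement function can be defined if and only if $\mathcal{U}$ is a linear code closed under intersection with $\mathbb{F}_q^n\in\mathcal{U}$.
   Context: $\mathbb{P}_q(n)$ is the set of all $\mathbb{F}_q$-subspaces of $\mathbb{F}_q^n$, a lattice under inclusion with join $X+Y$ and meet $X\cap Y$. The subspace distance is $d_S(X,Y)=\dim(X+Y)-\dim(X\cap Y)$. For $\mathcal{U}\subseteq\mathbb{P}_q(n)$ let $\mathcal{U}_k$ be its members of dimension $k$. A complement on $\mathcal{U}$ is a map $f:\mathcal{U}\to\mathcal{U}$ such that (i) $X\cap f(X)=\{0\}$ and $X\oplus f(X)=\mathbb{F}_q^n$ for all $X\in\mathcal{U}$; (ii) for each $0\le k\le n$ and each $X\in\mathcal{U}_k$, $f(X)$ is a uniquely determined element of $\mathcal{U}_{n-k}$; (iii) $f(f(X))=X$ for all $X$; (iv) $d_S(X,Y)=d_S(f(X),f(Y))$ for all $X,Y\in\mathcal{U}$. A subset $\mathcal{U}$ is a linear code if $\{0\}\in\mathcal{U}$ and there is $\boxplus:\mathcal{U}\times\mathcal{U}\to\mathcal{U}$ with $(\mathcal{U},\boxplus)$ an abelian group, $X\boxplus\{0\}=X$, $X\boxplus X=\{0\}$, and $d_S(X,Y)=d_S(X\boxplus W,Y\boxplus W)$ for all $X,Y,W\in\mathcal{U}$; it is closed under intersection if $X\cap Y\in\mathcal{U}$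 whenever $X,Y\in\mathcal{U}$. A distributive sublattice is a subset closed under $+$ and $\cap$ satisfying $X\cap(Y+Z)=(X\cap Y)+(X\cap Z)$. -}

module Defs where

open import Data.Nat using (ℕ; zero; suc; _∸_)
open import Data.Fin using (Fin)
open import Data.Fin.Properties using () renaming (_≟_ to _≟ᶠ_)
open import Data.Bool using (Bool; true; false; _∧_)
open import Data.List using (List; [_]; concatMap; map; allFin)
open import Data.Bool.ListAction using (any)
open import Data.Vec using (Vec; []; _∷_; lookup; tabulate; zipWith; replicate)
open import Data.Vec.Properties using (≡-dec)
open import Data.Product using (_×_; ∃; Σ; _,_)
open import Relation.Nullary using (¬_)
open import Relation.Nullary.Decidable using (⌊_⌋)
open import Relation.Binary.PropositionalEquality using (_≡_; _≢_)
open import Algebra.Structures using (IsCommutativeRing)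
open import Function.Bundles using (_⇔_)

record FiniteField (q : ℕ) : Set where
  field
    _+_ _*_ : Fin q → Fin q → Fin q
    -_ : Fin q → Fin q
    0# 1# : Fin q
    isCommutativeRing : IsCommutativeRing _≡_ _+_ _*_ -_ 0# 1#
    0≢1 : 0# ≢ 1#
    inverse : ∀ x → x ≢ 0# → ∃ λ y → x * y ≡ 1#

-- Subsets of Fin q ^ n, represented as a q-ary trie of booleans, so that
-- propositional equality of subsets is extensional equality.
VSet : ℕ → ℕ → Set
VSet q zero = Bool
VSet q (suc n) = Vec (VSet q n) q

member : ∀ {q n} → VSet q n → Vec (Fin q) n → Bool
member {n = zero} b [] = b
member {n = suc n} t (x ∷ v) = member (lookup t x) v

fromPred : ∀ {q n} → (Vec (Fin q) n → Bool) → VSet q n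
fromPred {n = zero} p = p []
fromPred {n = suc n} p = tabulate λ x → fromPred (λ v → p (x ∷ v))

allVecs : ∀ q n → List (Vec (Fin q) n)
allVecs q zero = [ [] ]
allVecs q (suc n) = concatMap (λ x → map (x ∷_) (allVecs q n)) (allFin q)

module Sub {q : ℕ} (F : FiniteField q) {n : ℕ} where
  open FiniteField F

  V : Set
  V = Vec (Fin q) n

  _∈ₛ_ : V → VSet q n → Set
  v ∈ₛ X = member X v ≡ true

  0v : V
  0v = replicate n 0#

  _+ᵥ_ : V → V → V
  _+ᵥ_ = zipWith _+_

  -ᵥ_ : V → V
  -ᵥ v = Data.Vec.map -_ v

  _·_ : Fin q → V → V
  c · v = Data.Vec.map (c *_) v

  IsSubspace : VSet q n → Set
  IsSubspace X = (0v ∈ₛ X)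
               × (∀ u v → u ∈ₛ X → v ∈ₛ X → (u +ᵥ v) ∈ₛ X)
               × (∀ c v → v ∈ₛ X → (c · v) ∈ₛ X)

  zeroSp : VSet q n
  zeroSp = fromPred (λ v → ⌊ ≡-dec _≟ᶠ_ v 0v ⌋)

  fullSp : VSet q n
  fullSp = fromPred (λ _ → true)

  -- meet X ∩ Y and join X + Y = { x + y | x ∈ X, y ∈ Y }
  _∩_ : VSet q n → VSet q n → VSet q n
  X ∩ Y = fromPred (λ v → member X v ∧ member Y v)

  _⊹_ : VSet q n → VSet q n → VSet q n
  X ⊹ Y = fromPred (λ v → any (λ x → member X x ∧ member Y (v +ᵥ (-ᵥ x))) (allVecs q n))

  lincomb : ∀ {k} → Vec (Fin q) k → Vec V k → V
  lincomb [] [] = 0v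
  lincomb (c ∷ cs) (b ∷ bs) = (c · b) +ᵥ lincomb cs bs

  HasDim : VSet q n → ℕ → Set
  HasDim X k = Σ (Vec V k) λ B →
      (∀ cs → lincomb cs B ≡ 0v → cs ≡ replicate k 0#)
    × (∀ v → v ∈ₛ X ⇔ ∃ λ cs → lincomb cs B ≡ v)

  -- d_S(X,Y) = d_S(Z,W), where d_S(X,Y) = dim(X+Y) - dim(X∩Y)
  SameDist : VSet q n → VSet q n → VSet q n → VSet q n → Set
  SameDist X Y Z W = ∀ a b c d → HasDim (X ⊹ Y) a → HasDim (X ∩ Y) b
                       → HasDim (Z ⊹ W) c → HasDim (Z ∩ W) d → a ∸ b ≡ c ∸ d

  Family : Set₁
  Family = VSet q n → Set

  InProjSpace : Family → Set
  InProjSpace U = ∀ X → U X → IsSubspace X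

  IsDistributiveSublattice : Family → Set
  IsDistributiveSublattice U =
      (∃ λ X → U X)
    × (∀ X Y → U X → U Y → U (X ⊹ Y))
    × (∀ X Y → U X → U Y → U (X ∩ Y))
    × (∀ X Y Z → U X → U Y → U Z → X ∩ (Y ⊹ Z) ≡ (X ∩ Y) ⊹ (X ∩ Z))

  IsComplement : Family → (VSet q n → VSet q n) → Set
  IsComplement U f =
      (∀ X → U X → U (f X))
    × (∀ X → U X → (X ∩ f X ≡ zeroSp) × (X ⊹ f X ≡ fullSp))
    × (∀ k X → U X → HasDim X k → HasDim (f X) (n ∸ k))
    × (∀ X → U X → f (f X) ≡ X)
    × (∀ X Y → U X → U Y → SameDist X Y (f X) (f Y))

  HasComplement : Family → Set
  HasComplement U = ∃ λ f → IsComplement U f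

  IsLinearCode : Family → Set
  IsLinearCode U =
      U zeroSp
    × (∃ λ (_⊞_ : VSet q n → VSet q n → VSet q n) →
          (∀ X Y → U X → U Y → U (X ⊞ Y))
        × (∀ X Y Z → U X → U Y → U Z → (X ⊞ Y) ⊞ Z ≡ X ⊞ (Y ⊞ Z))
        × (∀ X Y → U X → U Y → X ⊞ Y ≡ Y ⊞ X)
        × (∀ X → U X → X ⊞ zeroSp ≡ X)
        × (∀ X → U X → X ⊞ X ≡ zeroSp)
        × (∀ X Y W → U X → U Y → U W → SameDist X Y (X ⊞ W) (Y ⊞ W)))

  ClosedUnderIntersection : Family → Set
  ClosedUnderIntersection U = ∀ X Y → U X → U Y → U (X ∩ Y)

-- Forward direction: with the complement ∁, the symmetric difference X ⊞ Y = (X ∩ ∁Y) + (∁X ∩ Y)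
-- turns a complemented distributive sublattice into an elementary abelian 2-group with identity {0}.
-- Distributivity splits X + Y as the direct sum of X ∩ Y and X ⊞ Y, so
-- d(X,Y) = dim(X + Y) - dim(X ∩ Y) = dim(X ⊞ Y), which is invariant under X, Y ↦ X ⊞ W, Y ⊞ W.
--
-- Backward direction: ∁X = X ⊞ 𝔽ⁿ is an involutive isometry. Comparing d(X,{0}) = d(∁X,𝔽ⁿ) and
-- d({0},𝔽ⁿ) = d(X,∁X) with Grassmann's formula shows that ∁X is a complement of X of dimension n - dim X.
-- The same dimension count makes ∁ inclusion-reversing and gives X + Y = ∁(∁X ∩ ∁Y), so U is closed
-- under +; and d(X,Y) + d(X,∁Y) = n gives X = (X ∩ Y) + (X ∩ ∁Y), from which distributivity follows.

module Submission where

open import Defs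
open import Algebra.Bundles using (AbelianGroup; CommutativeSemigroup; Ring)
open import Algebra.Structures using (IsCommutativeRing)
import Algebra.Properties.AbelianGroup as AbelianGroupProperties
import Algebra.Properties.CommutativeSemigroup as CommutativeSemigroupProperties
import Algebra.Properties.Ring as RingProperties
open import Data.Bool using (Bool; true; false; _∧_) renaming (_≟_ to _≟ᵇ_)
open import Data.Bool.ListAction using (any)
open import Data.Bool.Properties using (T-≡)
open import Data.Empty using (⊥-elim)
open import Data.Fin as Fin using (Fin; combine; remQuot)
import Data.Fin.Properties as Fin
open import Data.Fin.Properties using () renaming (_≟_ to _≟ᶠ_)
open import Data.List as List using (List; []; _∷_)
open import Data.List.Membership.Propositional using (_∈_; lose)
open import Data.List.Membership.Propositional.Properties using (∈-concat⁺′; ∈-map⁺; ∈-allFin)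
open import Data.List.Relation.Unary.Any using (here; there; satisfied)
open import Data.List.Relation.Unary.Any.Properties using (any⁺; any⁻)
open import Data.Nat as ℕ using (ℕ; zero; suc; _∸_; _≤_; _<_; _^_)
import Data.Nat.Properties as ℕ
open import Data.Nat.Solver using (module +-*-Solver)
open import Data.Product using (_×_; ∃; ∃₂; _,_; proj₁; proj₂)
open import Data.Sum using (_⊎_; inj₁; inj₂)
open import Data.Vec as Vec using (Vec; []; _∷_; lookup; tabulate; zipWith; replicate; _++_; splitAt)
open import Data.Vec.Relation.Unary.All as All using (All; []; _∷_)
open import Data.Vec.Relation.Unary.All.Properties using (++ˡ⁻)
open import Data.Vec.Properties
  using (≡-dec; lookup∘tabulate; tabulate∘lookup; tabulate-cong; zipWith-assoc; zipWith-comm; ++-injectiveˡ; ++-injectiveʳ;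
         zipWith-identityˡ; zipWith-identityʳ; zipWith-inverseˡ; zipWith-inverseʳ)
open import Function using (_∘_; id)
open import Function.Bundles using (_⇔_; mk⇔; Equivalence)
open import Function.Definitions using (Injective)
open import Relation.Binary.PropositionalEquality
open import Relation.Binary.Definitions using (tri<; tri≈; tri>)
open import Relation.Nullary using (¬_; Dec; yes; no; ¬?; _×-dec_)
open import Relation.Nullary.Decidable using (⌊_⌋; toWitness; fromWitness)
open ≡-Reasoning

∧≡true⁻ : ∀ {a b} → a ∧ b ≡ true → a ≡ true × b ≡ true
∧≡true⁻ {true} b≡true = refl , b≡true

∧≡true⁺ : ∀ {a b} → a ≡ true → b ≡ true → a ∧ b ≡ true
∧≡true⁺ refl refl = refl

≡true-ext : ∀ {a b : Bool} → (a ≡ true → b ≡ true) → (b ≡ true → a ≡ true) → a ≡ b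
≡true-ext {true}  {true}  _ _ = refl
≡true-ext {true}  {false} f _ = sym (f refl)
≡true-ext {false} {true}  _ g = g refl
≡true-ext {false} {false} _ _ = refl

any≡true⁺ : ∀ {A : Set} (p : A → Bool) {x xs} → x ∈ xs → p x ≡ true → any p xs ≡ true
any≡true⁺ p x∈xs px = Equivalence.to T-≡ (any⁺ p (lose x∈xs (Equivalence.from T-≡ px)))

any≡true⁻ : ∀ {A : Set} (p : A → Bool) xs → any p xs ≡ true → ∃ λ x → p x ≡ true
any≡true⁻ p xs e with x , px ← satisfied (any⁻ p xs (Equivalence.from T-≡ e)) = x , Equivalence.to T-≡ px

find : ∀ {A : Set} {P : A → Set} → (∀ x → Dec (P x)) → (xs : List A)
     → ∃ P ⊎ (∀ {x} → x ∈ xs → ¬ P x)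
find P? [] = inj₂ λ ()
find P? (x ∷ xs) with P? x | find P? xs
... | yes px | _       = inj₁ (x , px)
... | no _   | inj₁ r  = inj₁ r
... | no ¬px | inj₂ ¬r = inj₂ λ { (here refl) → ¬px ; (there x∈xs) → ¬r x∈xs }

module _ {q : ℕ} where

  member-fromPred : ∀ {k} (p : Vec (Fin q) k → Bool) v → member (fromPred p) v ≡ p v
  member-fromPred {zero}  p []      = refl
  member-fromPred {suc k} p (x ∷ v)
    rewrite lookup∘tabulate (λ y → fromPred (λ w → p (y ∷ w))) x = member-fromPred (λ w → p (x ∷ w)) v

  VSet-ext : ∀ {k} (X Y : VSet q k) → (∀ v → member X v ≡ member Y v) → X ≡ Y
  VSet-ext {zero}  X Y h = h []
  VSet-ext {suc k} X Y h = begin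
    X                         ≡⟨ tabulate∘lookup X ⟨
    tabulate (lookup X)       ≡⟨ tabulate-cong (λ x → VSet-ext (lookup X x) (lookup Y x) (h ∘ (x ∷_))) ⟩
    tabulate (lookup Y)       ≡⟨ tabulate∘lookup Y ⟩
    Y                         ∎

  ∈-allVecs : ∀ {k} (v : Vec (Fin q) k) → v ∈ allVecs q k
  ∈-allVecs {zero}  []      = here refl
  ∈-allVecs {suc k} (x ∷ v) =
    ∈-concat⁺′ (∈-map⁺ (x ∷_) (∈-allVecs v)) (∈-map⁺ (λ y → List.map (y ∷_) (allVecs q k)) (∈-allFin x))

  toFin : ∀ {k} → Vec (Fin q) k → Fin (q ^ k)
  toFin []      = Fin.zero
  toFin (x ∷ v) = combine x (toFin v)

  fromFin : ∀ k → Fin (q ^ k) → Vec (Fin q) k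
  fromFin zero    _ = []
  fromFin (suc k) i = proj₁ (remQuot {q} (q ^ k) i) ∷ fromFin k (proj₂ (remQuot {q} (q ^ k) i))

  fromFin∘toFin : ∀ {k} (v : Vec (Fin q) k) → fromFin k (toFin v) ≡ v
  fromFin∘toFin []               = refl
  fromFin∘toFin {suc k} (x ∷ v) = begin
    fromFin (suc k) (combine x (toFin v))
      ≡⟨ cong (λ (y , i) → y ∷ fromFin k i) (Fin.remQuot-combine {q} {q ^ k} x (toFin v)) ⟩
    x ∷ fromFin k (toFin v)
      ≡⟨ cong (x ∷_) (fromFin∘toFin v) ⟩
    x ∷ v ∎

  toFin∘fromFin : ∀ k (i : Fin (q ^ k)) → toFin (fromFin k i) ≡ i
  toFin∘fromFin zero    Fin.zero = refl
  toFin∘fromFin (suc k) i        = begin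
    combine x (toFin (fromFin k j)) ≡⟨ cong (combine x) (toFin∘fromFin k j) ⟩
    combine x j                     ≡⟨ Fin.combine-remQuot {q} (q ^ k) i ⟩
    i                               ∎
    where
    x = proj₁ (remQuot {q} (q ^ k) i)
    j = proj₂ (remQuot {q} (q ^ k) i)

  toFin-injective : ∀ {k} → Injective _≡_ _≡_ (toFin {k})
  toFin-injective {x = u} {v} e = trans (sym (fromFin∘toFin u)) (trans (cong (fromFin _) e) (fromFin∘toFin v))

  fromFin-injective : ∀ k → Injective _≡_ _≡_ (fromFin k)
  fromFin-injective k {i} {j} e = trans (sym (toFin∘fromFin k i)) (trans (cong toFin e) (toFin∘fromFin k j))

  injective⇒length≤ : ∀ {k m} → 1 < q → (g : Vec (Fin q) k → Vec (Fin q) m) → Injective _≡_ _≡_ g → k ≤ m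
  injective⇒length≤ {k} {m} 1<q g g-inj with ℕ.≤-<-connex k m
  ... | inj₁ k≤m = k≤m
  ... | inj₂ m<k = ⊥-elim (ℕ.<⇒≱ (ℕ.^-monoʳ-< q 1<q m<k) (Fin.injective⇒≤ {f = toFin ∘ g ∘ fromFin k}
                            (fromFin-injective k ∘ g-inj ∘ toFin-injective)))

open CommutativeSemigroupProperties ℕ.+-commutativeSemigroup using () renaming (interchange to +-interchange)

m+m≡n+n⇒m≡n : ∀ {m n} → m ℕ.+ m ≡ n ℕ.+ n → m ≡ n
m+m≡n+n⇒m≡n {m} {n} e with ℕ.<-cmp m n
... | tri< m<n _ _ = ⊥-elim (ℕ.<-irrefl e (ℕ.+-mono-< m<n m<n))
... | tri≈ _ m≡n _ = m≡n
... | tri> _ _ n<m = ⊥-elim (ℕ.<-irrefl (sym e) (ℕ.+-mono-< n<m n<m))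

m+n≡o⇒o+n≡m⇒n≡0 : ∀ {m n o} → m ℕ.+ n ≡ o → o ℕ.+ n ≡ m → n ≡ 0
m+n≡o⇒o+n≡m⇒n≡0 {m} {n} {o} e₁ e₂ = ℕ.m+n≡0⇒m≡0 n (ℕ.+-cancelˡ-≡ m (n ℕ.+ n) 0 (begin
  m ℕ.+ (n ℕ.+ n)   ≡⟨ ℕ.+-assoc m n n ⟨
  (m ℕ.+ n) ℕ.+ n   ≡⟨ cong (ℕ._+ n) e₁ ⟩
  o ℕ.+ n           ≡⟨ e₂ ⟩
  m                 ≡⟨ ℕ.+-identityʳ m ⟨
  m ℕ.+ 0           ∎))

∸≡∸⇒+≡+ : ∀ {a b c d} → b ≤ a → d ≤ c → a ∸ b ≡ c ∸ d → a ℕ.+ d ≡ c ℕ.+ b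
∸≡∸⇒+≡+ {a} {b} {c} {d} b≤a d≤c e = begin
  a ℕ.+ d                   ≡⟨ cong (ℕ._+ d) (ℕ.m∸n+n≡m b≤a) ⟨
  (a ∸ b) ℕ.+ b ℕ.+ d       ≡⟨ cong (λ x → x ℕ.+ b ℕ.+ d) e ⟩
  (c ∸ d) ℕ.+ b ℕ.+ d       ≡⟨ ℕ.+-assoc (c ∸ d) b d ⟩
  (c ∸ d) ℕ.+ (b ℕ.+ d)     ≡⟨ cong ((c ∸ d) ℕ.+_) (ℕ.+-comm b d) ⟩
  (c ∸ d) ℕ.+ (d ℕ.+ b)     ≡⟨ ℕ.+-assoc (c ∸ d) d b ⟨
  (c ∸ d) ℕ.+ d ℕ.+ b       ≡⟨ cong (ℕ._+ b) (ℕ.m∸n+n≡m d≤c) ⟩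
  c ℕ.+ b                   ∎

module Vectors {q : ℕ} (F : FiniteField q) where
  open FiniteField F
  open IsCommutativeRing isCommutativeRing
    using (+-assoc; +-comm; +-identityˡ; +-identityʳ; -‿inverseˡ; -‿inverseʳ;
           *-assoc; *-identityˡ; distribˡ; distribʳ; zeroˡ; zeroʳ; isRing)

  private
    ring : Ring _ _
    ring = record { isRing = isRing }

  open RingProperties ring using (-1*x≈-x; -‿distribʳ-*)

  -- The vector operations of Sub F {k} for all lengths k at once, so that they also act on coefficient
  -- vectors; at length n they are definitionally _+ᵥ_, -ᵥ_, _·_ and 0v.
  infixl 6 _⊕_
  infixr 7 _⊙_
  infix  8 ⊖_

  _⊕_ : ∀ {k} → Vec (Fin q) k → Vec (Fin q) k → Vec (Fin q) k
  _⊕_ = zipWith _+_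

  ⊖_ : ∀ {k} → Vec (Fin q) k → Vec (Fin q) k
  ⊖_ = Vec.map -_

  _⊙_ : ∀ {k} → Fin q → Vec (Fin q) k → Vec (Fin q) k
  c ⊙ v = Vec.map (c *_) v

  𝟎 : ∀ k → Vec (Fin q) k
  𝟎 k = replicate k 0#

  𝟎-++ : ∀ a b → 𝟎 (a ℕ.+ b) ≡ 𝟎 a ++ 𝟎 b
  𝟎-++ zero    b = refl
  𝟎-++ (suc a) b = cong (0# ∷_) (𝟎-++ a b)

  ⊕-abelianGroup : ℕ → AbelianGroup _ _
  ⊕-abelianGroup k = record
    { _∙_ = _⊕_ {k} ; ε = 𝟎 k ; _⁻¹ = ⊖_
    ; isAbelianGroup = record
      { isGroup = record
        { isMonoid = record
          { isSemigroup = record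
            { isMagma = record { isEquivalence = isEquivalence ; ∙-cong = cong₂ _⊕_ }
            ; assoc = zipWith-assoc +-assoc }
          ; identity = zipWith-identityˡ +-identityˡ , zipWith-identityʳ +-identityʳ }
        ; inverse = zipWith-inverseˡ -‿inverseˡ , zipWith-inverseʳ -‿inverseʳ
        ; ⁻¹-cong = cong ⊖_ }
      ; comm = zipWith-comm +-comm } }

  module _ {k : ℕ} where
    open AbelianGroup (⊕-abelianGroup k) public
      using ()
      renaming (assoc to ⊕-assoc; comm to ⊕-comm; identityˡ to ⊕-identityˡ; identityʳ to ⊕-identityʳ;
                inverseˡ to ⊕-inverseˡ; inverseʳ to ⊕-inverseʳ)
    open AbelianGroupProperties (⊕-abelianGroup k) public
      using ()
      renaming (inverseʳ-unique to ⊖-unique; ⁻¹-involutive to ⊖-involutive;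
                x∙y⁻¹≈ε⇒x≈y to x⊕⊖y≡𝟎⇒x≡y;
                //-rightDividesˡ to ⊖⊕-cancelʳ; //-rightDividesʳ to ⊕⊖-cancelʳ)
    open CommutativeSemigroupProperties (AbelianGroup.commutativeSemigroup (⊕-abelianGroup k)) public
      using ()
      renaming (interchange to ⊕-interchange)

  ⊙-distribˡ : ∀ {k} c (u v : Vec (Fin q) k) → c ⊙ (u ⊕ v) ≡ c ⊙ u ⊕ c ⊙ v
  ⊙-distribˡ c []      []      = refl
  ⊙-distribˡ c (a ∷ u) (b ∷ v) = cong₂ _∷_ (distribˡ c a b) (⊙-distribˡ c u v)

  ⊙-distribʳ : ∀ {k} c d (u : Vec (Fin q) k) → (c + d) ⊙ u ≡ c ⊙ u ⊕ d ⊙ u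
  ⊙-distribʳ c d []      = refl
  ⊙-distribʳ c d (a ∷ u) = cong₂ _∷_ (distribʳ a c d) (⊙-distribʳ c d u)

  ⊙-assoc : ∀ {k} c d (u : Vec (Fin q) k) → (c * d) ⊙ u ≡ c ⊙ d ⊙ u
  ⊙-assoc c d []      = refl
  ⊙-assoc c d (a ∷ u) = cong₂ _∷_ (*-assoc c d a) (⊙-assoc c d u)

  ⊙-identityˡ : ∀ {k} (u : Vec (Fin q) k) → 1# ⊙ u ≡ u
  ⊙-identityˡ []      = refl
  ⊙-identityˡ (a ∷ u) = cong₂ _∷_ (*-identityˡ a) (⊙-identityˡ u)

  ⊙-zeroˡ : ∀ {k} (u : Vec (Fin q) k) → 0# ⊙ u ≡ 𝟎 k
  ⊙-zeroˡ []      = refl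
  ⊙-zeroˡ (a ∷ u) = cong₂ _∷_ (zeroˡ a) (⊙-zeroˡ u)

  ⊙-zeroʳ : ∀ {k} c → c ⊙ 𝟎 k ≡ 𝟎 k
  ⊙-zeroʳ {zero}  c = refl
  ⊙-zeroʳ {suc k} c = cong₂ _∷_ (zeroʳ c) (⊙-zeroʳ c)

  ⊖≡-1⊙ : ∀ {k} (u : Vec (Fin q) k) → ⊖ u ≡ (- 1#) ⊙ u
  ⊖≡-1⊙ []      = refl
  ⊖≡-1⊙ (a ∷ u) = cong₂ _∷_ (sym (-1*x≈-x a)) (⊖≡-1⊙ u)

  ⊙-⊖-comm : ∀ {k} c (u : Vec (Fin q) k) → c ⊙ ⊖ u ≡ ⊖ (c ⊙ u)
  ⊙-⊖-comm c []      = refl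
  ⊙-⊖-comm c (a ∷ u) = cong₂ _∷_ (sym (-‿distribʳ-* c a)) (⊙-⊖-comm c u)

module Subspaces {q : ℕ} (F : FiniteField q) {n : ℕ} where
  open FiniteField F
  open Sub F {n}
  open Vectors F

  infix 4 _⊆_
  _⊆_ : VSet q n → VSet q n → Set
  X ⊆ Y = ∀ v → v ∈ₛ X → v ∈ₛ Y

  ⊆-antisym : ∀ {X Y} → X ⊆ Y → Y ⊆ X → X ≡ Y
  ⊆-antisym {X} {Y} X⊆Y Y⊆X = VSet-ext X Y (λ v → ≡true-ext (X⊆Y v) (Y⊆X v))

  ∈-fullSp : ∀ v → v ∈ₛ fullSp
  ∈-fullSp = member-fromPred (λ _ → true)

  member-zeroSp : ∀ v → member zeroSp v ≡ ⌊ ≡-dec _≟ᶠ_ v 0v ⌋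
  member-zeroSp = member-fromPred _

  member-∩ : ∀ X Y v → member (X ∩ Y) v ≡ member X v ∧ member Y v
  member-∩ X Y = member-fromPred _

  member-⊹ : ∀ X Y v → member (X ⊹ Y) v ≡ any (λ x → member X x ∧ member Y (v +ᵥ (-ᵥ x))) (allVecs q n)
  member-⊹ X Y = member-fromPred _

  ∈-zeroSp⁻ : ∀ v → v ∈ₛ zeroSp → v ≡ 0v
  ∈-zeroSp⁻ v v∈0 = toWitness (Equivalence.from T-≡ (trans (sym (member-zeroSp v)) v∈0))

  0v∈zeroSp : 0v ∈ₛ zeroSp
  0v∈zeroSp = trans (member-zeroSp 0v) (Equivalence.to T-≡ (fromWitness refl))

  ∈-∩⁻ : ∀ {X Y} v → v ∈ₛ (X ∩ Y) → v ∈ₛ X × v ∈ₛ Y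
  ∈-∩⁻ {X} {Y} v v∈ = ∧≡true⁻ (trans (sym (member-∩ X Y v)) v∈)

  ∈-∩⁺ : ∀ {X Y} v → v ∈ₛ X → v ∈ₛ Y → v ∈ₛ (X ∩ Y)
  ∈-∩⁺ {X} {Y} v v∈X v∈Y = trans (member-∩ X Y v) (∧≡true⁺ v∈X v∈Y)

  ∩⊆ˡ : ∀ {X Y} → X ∩ Y ⊆ X
  ∩⊆ˡ v v∈ = proj₁ (∈-∩⁻ v v∈)

  ∩⊆ʳ : ∀ {X Y} → X ∩ Y ⊆ Y
  ∩⊆ʳ v v∈ = proj₂ (∈-∩⁻ v v∈)

  ∈-⊹⁺ : ∀ {X Y} x y → x ∈ₛ X → y ∈ₛ Y → (x +ᵥ y) ∈ₛ (X ⊹ Y)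
  ∈-⊹⁺ {X} {Y} x y x∈X y∈Y =
    trans (member-⊹ X Y (x +ᵥ y)) (any≡true⁺ _ (∈-allVecs x) (∧≡true⁺ x∈X (subst (_∈ₛ Y) (sym x+y-x≡y) y∈Y)))
    where
    x+y-x≡y : (x +ᵥ y) +ᵥ (-ᵥ x) ≡ y
    x+y-x≡y = trans (cong (_+ᵥ (-ᵥ x)) (⊕-comm x y)) (⊕⊖-cancelʳ x y)

  ∈-⊹⁻ : ∀ {X Y} v → v ∈ₛ (X ⊹ Y) → ∃₂ λ x y → x ∈ₛ X × y ∈ₛ Y × v ≡ x +ᵥ y
  ∈-⊹⁻ {X} {Y} v v∈
    with x , e ← any≡true⁻ _ (allVecs q n) (trans (sym (member-⊹ X Y v)) v∈)
    with x∈X , v-x∈Y ← ∧≡true⁻ e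
    = x , v +ᵥ (-ᵥ x) , x∈X , v-x∈Y , sym (trans (⊕-comm x (v +ᵥ (-ᵥ x))) (⊖⊕-cancelʳ x v))

  module _ {X} (sX : IsSubspace X) where
    0v-∈ : 0v ∈ₛ X
    0v-∈ = proj₁ sX

    +ᵥ-∈ : ∀ {u v} → u ∈ₛ X → v ∈ₛ X → (u +ᵥ v) ∈ₛ X
    +ᵥ-∈ = proj₁ (proj₂ sX) _ _

    ·-∈ : ∀ c {v} → v ∈ₛ X → (c · v) ∈ₛ X
    ·-∈ c = proj₂ (proj₂ sX) c _

    -ᵥ-∈ : ∀ {v} → v ∈ₛ X → (-ᵥ v) ∈ₛ X
    -ᵥ-∈ {v} v∈X = subst (_∈ₛ X) (sym (⊖≡-1⊙ v)) (·-∈ (- 1#) v∈X)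

    ∸-∈ : ∀ {u v} → u ∈ₛ X → v ∈ₛ X → (u +ᵥ (-ᵥ v)) ∈ₛ X
    ∸-∈ u∈X v∈X = +ᵥ-∈ u∈X (-ᵥ-∈ v∈X)

  ∩-isSubspace : ∀ {X Y} → IsSubspace X → IsSubspace Y → IsSubspace (X ∩ Y)
  ∩-isSubspace sX sY =
      ∈-∩⁺ 0v (0v-∈ sX) (0v-∈ sY)
    , (λ u v u∈ v∈ → ∈-∩⁺ _ (+ᵥ-∈ sX (∩⊆ˡ u u∈) (∩⊆ˡ v v∈))
                           (+ᵥ-∈ sY (∩⊆ʳ u u∈) (∩⊆ʳ v v∈)))
    , (λ c v v∈ → ∈-∩⁺ _ (·-∈ sX c (∩⊆ˡ v v∈)) (·-∈ sY c (∩⊆ʳ v v∈)))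

  ⊹-isSubspace : ∀ {X Y} → IsSubspace X → IsSubspace Y → IsSubspace (X ⊹ Y)
  ⊹-isSubspace {X} {Y} sX sY =
    subst (_∈ₛ (X ⊹ Y)) (⊕-identityʳ 0v) (∈-⊹⁺ 0v 0v (0v-∈ sX) (0v-∈ sY)) , +-closed , ·-closed
    where
    +-closed : ∀ u v → u ∈ₛ (X ⊹ Y) → v ∈ₛ (X ⊹ Y) → (u +ᵥ v) ∈ₛ (X ⊹ Y)
    +-closed u v u∈ v∈
      with x₁ , y₁ , x₁∈ , y₁∈ , refl ← ∈-⊹⁻ u u∈
      with x₂ , y₂ , x₂∈ , y₂∈ , refl ← ∈-⊹⁻ v v∈
      = subst (_∈ₛ (X ⊹ Y)) (sym (⊕-interchange x₁ y₁ x₂ y₂))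
              (∈-⊹⁺ _ _ (+ᵥ-∈ sX x₁∈ x₂∈) (+ᵥ-∈ sY y₁∈ y₂∈))
    ·-closed : ∀ c v → v ∈ₛ (X ⊹ Y) → (c · v) ∈ₛ (X ⊹ Y)
    ·-closed c v v∈ with x , y , x∈ , y∈ , refl ← ∈-⊹⁻ v v∈ =
      subst (_∈ₛ (X ⊹ Y)) (sym (⊙-distribˡ c x y)) (∈-⊹⁺ _ _ (·-∈ sX c x∈) (·-∈ sY c y∈))

  zeroSp-isSubspace : IsSubspace zeroSp
  zeroSp-isSubspace =
      0v∈zeroSp
    , (λ u v u∈ v∈ → subst (_∈ₛ zeroSp)
         (sym (trans (cong₂ _+ᵥ_ (∈-zeroSp⁻ u u∈) (∈-zeroSp⁻ v v∈)) (⊕-identityʳ 0v))) 0v∈zeroSp)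
    , (λ c v v∈ → subst (_∈ₛ zeroSp) (sym (trans (cong (c ·_) (∈-zeroSp⁻ v v∈)) (⊙-zeroʳ c))) 0v∈zeroSp)

  fullSp-isSubspace : IsSubspace fullSp
  fullSp-isSubspace = ∈-fullSp 0v , (λ u v _ _ → ∈-fullSp _) , (λ c v _ → ∈-fullSp _)

  ⊆-⊹ˡ : ∀ {X Y} → IsSubspace Y → X ⊆ X ⊹ Y
  ⊆-⊹ˡ {X} {Y} sY v v∈X = subst (_∈ₛ (X ⊹ Y)) (⊕-identityʳ v) (∈-⊹⁺ v 0v v∈X (0v-∈ sY))

  ⊆-⊹ʳ : ∀ {X Y} → IsSubspace X → Y ⊆ X ⊹ Y
  ⊆-⊹ʳ {X} {Y} sX v v∈Y = subst (_∈ₛ (X ⊹ Y)) (⊕-identityˡ v) (∈-⊹⁺ 0v v (0v-∈ sX) v∈Y)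

  ⊹-least : ∀ {X Y Z} → IsSubspace Z → X ⊆ Z → Y ⊆ Z → X ⊹ Y ⊆ Z
  ⊹-least sZ X⊆Z Y⊆Z v v∈ with x , y , x∈ , y∈ , refl ← ∈-⊹⁻ v v∈ = +ᵥ-∈ sZ (X⊆Z x x∈) (Y⊆Z y y∈)

  ∩-greatest : ∀ {X Y Z} → Z ⊆ X → Z ⊆ Y → Z ⊆ X ∩ Y
  ∩-greatest Z⊆X Z⊆Y v v∈ = ∈-∩⁺ v (Z⊆X v v∈) (Z⊆Y v v∈)

  ∩-comm : ∀ X Y → X ∩ Y ≡ Y ∩ X
  ∩-comm X Y = ⊆-antisym (∩-greatest ∩⊆ʳ ∩⊆ˡ) (∩-greatest ∩⊆ʳ ∩⊆ˡ)

  ∩-assoc : ∀ X Y Z → (X ∩ Y) ∩ Z ≡ X ∩ (Y ∩ Z)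
  ∩-assoc X Y Z = ⊆-antisym
    (∩-greatest (λ v → ∩⊆ˡ v ∘ ∩⊆ˡ v) (∩-greatest (λ v → ∩⊆ʳ {X} v ∘ ∩⊆ˡ v) ∩⊆ʳ))
    (∩-greatest (∩-greatest ∩⊆ˡ (λ v → ∩⊆ˡ v ∘ ∩⊆ʳ {X} v)) (λ v → ∩⊆ʳ {Y} v ∘ ∩⊆ʳ v))

  ⊹-comm : ∀ X Y → X ⊹ Y ≡ Y ⊹ X
  ⊹-comm X Y = ⊆-antisym (swap X Y) (swap Y X)
    where
    swap : ∀ X Y → X ⊹ Y ⊆ Y ⊹ X
    swap X Y v v∈ with x , y , x∈ , y∈ , refl ← ∈-⊹⁻ v v∈ =
      subst (_∈ₛ (Y ⊹ X)) (⊕-comm y x) (∈-⊹⁺ y x y∈ x∈)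

  ⊹-assoc : ∀ X Y Z → (X ⊹ Y) ⊹ Z ≡ X ⊹ (Y ⊹ Z)
  ⊹-assoc X Y Z = ⊆-antisym ⊆→ ⊆←
    where
    ⊆→ : (X ⊹ Y) ⊹ Z ⊆ X ⊹ (Y ⊹ Z)
    ⊆→ v v∈
      with xy , z , xy∈ , z∈ , refl ← ∈-⊹⁻ v v∈
      with x , y , x∈ , y∈ , refl ← ∈-⊹⁻ xy xy∈
      = subst (_∈ₛ (X ⊹ (Y ⊹ Z))) (sym (⊕-assoc x y z)) (∈-⊹⁺ x _ x∈ (∈-⊹⁺ y z y∈ z∈))
    ⊆← : X ⊹ (Y ⊹ Z) ⊆ (X ⊹ Y) ⊹ Z
    ⊆← v v∈
      with x , yz , x∈ , yz∈ , refl ← ∈-⊹⁻ v v∈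
      with y , z , y∈ , z∈ , refl ← ∈-⊹⁻ yz yz∈
      = subst (_∈ₛ ((X ⊹ Y) ⊹ Z)) (⊕-assoc x y z) (∈-⊹⁺ _ z (∈-⊹⁺ x y x∈ y∈) z∈)

  ⊹-commutativeSemigroup : CommutativeSemigroup _ _
  ⊹-commutativeSemigroup = record
    { _∙_ = _⊹_
    ; isCommutativeSemigroup = record
      { isSemigroup = record
        { isMagma = record { isEquivalence = isEquivalence ; ∙-cong = cong₂ _⊹_ }
        ; assoc = ⊹-assoc }
      ; comm = ⊹-comm } }

  open CommutativeSemigroupProperties ⊹-commutativeSemigroup public
    using () renaming (interchange to ⊹-interchange)

  ⊆⇒⊹≡ʳ : ∀ {X Y} → IsSubspace X → IsSubspace Y → X ⊆ Y → X ⊹ Y ≡ Y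
  ⊆⇒⊹≡ʳ sX sY X⊆Y = ⊆-antisym (⊹-least sY X⊆Y (λ _ → id)) (⊆-⊹ʳ sX)

  ⊆⇒∩≡ˡ : ∀ {X Y} → X ⊆ Y → X ∩ Y ≡ X
  ⊆⇒∩≡ˡ X⊆Y = ⊆-antisym ∩⊆ˡ (∩-greatest (λ _ → id) X⊆Y)

  ⊹-idem : ∀ {X} → IsSubspace X → X ⊹ X ≡ X
  ⊹-idem sX = ⊆⇒⊹≡ʳ sX sX (λ _ → id)

  ⊹-identityʳ : ∀ X → X ⊹ zeroSp ≡ X
  ⊹-identityʳ X = ⊆-antisym ⊆X (⊆-⊹ˡ zeroSp-isSubspace)
    where
    ⊆X : X ⊹ zeroSp ⊆ X
    ⊆X v v∈ with x , z , x∈ , z∈ , refl ← ∈-⊹⁻ v v∈ =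
      subst (_∈ₛ X) (sym (trans (cong (x +ᵥ_) (∈-zeroSp⁻ z z∈)) (⊕-identityʳ x))) x∈

  ⊹-identityˡ : ∀ X → zeroSp ⊹ X ≡ X
  ⊹-identityˡ X = trans (⊹-comm zeroSp X) (⊹-identityʳ X)

  ⊹-zeroʳ : ∀ {X} → IsSubspace X → X ⊹ fullSp ≡ fullSp
  ⊹-zeroʳ sX = ⊆⇒⊹≡ʳ sX fullSp-isSubspace (λ v _ → ∈-fullSp v)

  ∩-identityʳ : ∀ X → X ∩ fullSp ≡ X
  ∩-identityʳ X = ⊆⇒∩≡ˡ (λ v _ → ∈-fullSp v)

  ∩-zeroʳ : ∀ {X} → IsSubspace X → X ∩ zeroSp ≡ zeroSp
  ∩-zeroʳ sX = trans (∩-comm _ zeroSp) (⊆⇒∩≡ˡ (λ v v∈ → subst (_∈ₛ _) (sym (∈-zeroSp⁻ v v∈)) (0v-∈ sX)))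

  ∩⊆⊹ : ∀ {X Y} → IsSubspace Y → X ∩ Y ⊆ X ⊹ Y
  ∩⊆⊹ sY v v∈ = ⊆-⊹ˡ sY v (∩⊆ˡ v v∈)

  disjoint : ∀ {X Y} → IsSubspace X → IsSubspace Y → (∀ v → v ∈ₛ X → v ∈ₛ Y → v ≡ 0v) → X ∩ Y ≡ zeroSp
  disjoint sX sY only-0 = ⊆-antisym
    (λ v v∈ → subst (_∈ₛ zeroSp) (sym (only-0 v (∩⊆ˡ v v∈) (∩⊆ʳ v v∈))) 0v∈zeroSp)
    (λ v v∈ → subst (_∈ₛ _) (sym (∈-zeroSp⁻ v v∈)) (0v-∈ (∩-isSubspace sX sY)))

  ∩-⊹-⊇ : ∀ {X Y Z} → IsSubspace X → (X ∩ Y) ⊹ (X ∩ Z) ⊆ X ∩ (Y ⊹ Z)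
  ∩-⊹-⊇ sX v v∈ with a , b , a∈ , b∈ , refl ← ∈-⊹⁻ v v∈ =
    ∈-∩⁺ _ (+ᵥ-∈ sX (∩⊆ˡ a a∈) (∩⊆ˡ b b∈)) (∈-⊹⁺ a b (∩⊆ʳ a a∈) (∩⊆ʳ b b∈))

  -- Write v = y + z ∈ X with y = y₁ + y₂, z = z₁ + z₂ split along X and X′: then y₂ + z₂ ∈ X ∩ X′ = 0.
  splitting⇒∩-⊹-⊆ : ∀ {X X′ Y Z} → IsSubspace X → IsSubspace X′ → X ∩ X′ ≡ zeroSp
                  → Y ⊆ (Y ∩ X) ⊹ (Y ∩ X′) → Z ⊆ (Z ∩ X) ⊹ (Z ∩ X′) → X ∩ (Y ⊹ Z) ⊆ (X ∩ Y) ⊹ (X ∩ Z)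
  splitting⇒∩-⊹-⊆ {X} {X′} {Y} {Z} sX sX′ X∩X′≡0 Y-splits Z-splits v v∈
    with v∈X , v∈Y⊹Z ← ∈-∩⁻ v v∈
    with y , z , y∈Y , z∈Z , refl ← ∈-⊹⁻ v v∈Y⊹Z
    with y₁ , y₂ , y₁∈ , y₂∈ , refl ← ∈-⊹⁻ y (Y-splits y y∈Y)
    with z₁ , z₂ , z₁∈ , z₂∈ , refl ← ∈-⊹⁻ z (Z-splits z z∈Z)
    = subst (_∈ₛ ((X ∩ Y) ⊹ (X ∩ Z))) (sym v≡y₁+z₁)
        (∈-⊹⁺ y₁ z₁ (∈-∩⁺ y₁ (∩⊆ʳ y₁ y₁∈) (∩⊆ˡ y₁ y₁∈))
                    (∈-∩⁺ z₁ (∩⊆ʳ z₁ z₁∈) (∩⊆ˡ z₁ z₁∈)))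
    where
    x₁ = y₁ +ᵥ z₁
    x₂ = y₂ +ᵥ z₂
    v≡x₁+x₂ : (y₁ +ᵥ y₂) +ᵥ (z₁ +ᵥ z₂) ≡ x₁ +ᵥ x₂
    v≡x₁+x₂ = ⊕-interchange y₁ y₂ z₁ z₂
    x₁∈X : x₁ ∈ₛ X
    x₁∈X = +ᵥ-∈ sX (∩⊆ʳ y₁ y₁∈) (∩⊆ʳ z₁ z₁∈)
    x₂∈X : x₂ ∈ₛ X
    x₂∈X = subst (_∈ₛ X) (trans (cong (_+ᵥ (-ᵥ x₁)) (⊕-comm x₁ x₂)) (⊕⊖-cancelʳ x₁ x₂))
                 (∸-∈ sX (subst (_∈ₛ X) v≡x₁+x₂ v∈X) x₁∈X)
    x₂∈X′ : x₂ ∈ₛ X′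
    x₂∈X′ = +ᵥ-∈ sX′ (∩⊆ʳ y₂ y₂∈) (∩⊆ʳ z₂ z₂∈)
    x₂≡0 : x₂ ≡ 0v
    x₂≡0 = ∈-zeroSp⁻ x₂ (subst (x₂ ∈ₛ_) X∩X′≡0 (∈-∩⁺ x₂ x₂∈X x₂∈X′))
    v≡y₁+z₁ : (y₁ +ᵥ y₂) +ᵥ (z₁ +ᵥ z₂) ≡ x₁
    v≡y₁+z₁ = trans v≡x₁+x₂ (trans (cong (x₁ +ᵥ_) x₂≡0) (⊕-identityʳ x₁))

module Dimension {q : ℕ} (F : FiniteField q) {n : ℕ} where
  open FiniteField F
  open IsCommutativeRing isCommutativeRing using (*-comm)
  open Sub F {n}
  open Vectors F
  open Subspaces F {n}

  lincomb-𝟎 : ∀ {k} (B : Vec V k) → lincomb (𝟎 k) B ≡ 0v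
  lincomb-𝟎 []      = refl
  lincomb-𝟎 (b ∷ B) = trans (cong₂ _+ᵥ_ (⊙-zeroˡ b) (lincomb-𝟎 B)) (⊕-identityʳ 0v)

  lincomb-++ : ∀ {k m} (cs : Vec (Fin q) k) (ds : Vec (Fin q) m) B C
             → lincomb (cs ++ ds) (B ++ C) ≡ lincomb cs B +ᵥ lincomb ds C
  lincomb-++ []       ds []      C = sym (⊕-identityˡ _)
  lincomb-++ (c ∷ cs) ds (b ∷ B) C =
    trans (cong ((c · b) +ᵥ_) (lincomb-++ cs ds B C)) (sym (⊕-assoc (c · b) _ _))

  lincomb-⊕ : ∀ {k} (cs ds : Vec (Fin q) k) B → lincomb (cs ⊕ ds) B ≡ lincomb cs B +ᵥ lincomb ds B
  lincomb-⊕ []       []       []      = sym (⊕-identityʳ 0v)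
  lincomb-⊕ (c ∷ cs) (d ∷ ds) (b ∷ B) =
    trans (cong₂ _+ᵥ_ (⊙-distribʳ c d b) (lincomb-⊕ cs ds B)) (⊕-interchange (c · b) (d · b) _ _)

  lincomb-⊙ : ∀ {k} c (cs : Vec (Fin q) k) B → lincomb (c ⊙ cs) B ≡ c · lincomb cs B
  lincomb-⊙ c []       []      = sym (⊙-zeroʳ c)
  lincomb-⊙ c (d ∷ cs) (b ∷ B) =
    trans (cong₂ _+ᵥ_ (⊙-assoc c d b) (lincomb-⊙ c cs B)) (sym (⊙-distribˡ c (d · b) _))

  lincomb-⊖ : ∀ {k} (cs : Vec (Fin q) k) B → lincomb (⊖ cs) B ≡ -ᵥ lincomb cs B
  lincomb-⊖ cs B = begin
    lincomb (⊖ cs) B            ≡⟨ cong (λ ds → lincomb ds B) (⊖≡-1⊙ cs) ⟩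
    lincomb ((- 1#) ⊙ cs) B     ≡⟨ lincomb-⊙ (- 1#) cs B ⟩
    (- 1#) · lincomb cs B       ≡⟨ ⊖≡-1⊙ _ ⟨
    -ᵥ lincomb cs B             ∎

  lincomb-∈ : ∀ {X k} {B : Vec V k} → IsSubspace X → All (_∈ₛ X) B → ∀ cs → lincomb cs B ∈ₛ X
  lincomb-∈ sX []           []       = 0v-∈ sX
  lincomb-∈ sX (b∈X ∷ B⊆X) (c ∷ cs) = +ᵥ-∈ sX (·-∈ sX c b∈X) (lincomb-∈ sX B⊆X cs)

  InSpan : ∀ {k} → Vec V k → V → Set
  InSpan B v = ∃ λ cs → lincomb cs B ≡ v

  Independent : ∀ {k} → Vec V k → Set
  Independent {k} B = ∀ cs → lincomb cs B ≡ 0v → cs ≡ 𝟎 k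

  Spans : VSet q n → ∀ {k} → Vec V k → Set
  Spans X B = ∀ v → v ∈ₛ X ⇔ InSpan B v

  IsBasis : VSet q n → ∀ {k} → Vec V k → Set
  IsBasis X B = Independent B × Spans X B

  inSpan? : ∀ {k} (B : Vec V k) v → Dec (InSpan B v)
  inSpan? {k} B v with find (λ cs → ≡-dec _≟ᶠ_ (lincomb cs B) v) (allVecs q k)
  ... | inj₁ found = yes found
  ... | inj₂ none  = no λ (cs , e) → none (∈-allVecs cs) e

  spans⇒All : ∀ {X k} (B : Vec V k) → Spans X B → All (_∈ₛ X) B
  spans⇒All {X} B B-spans = combinations⇒All B (λ cs → Equivalence.from (B-spans _) (cs , refl))
    where
    combinations⇒All : ∀ {k} (B : Vec V k) → (∀ cs → lincomb cs B ∈ₛ X) → All (_∈ₛ X) B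
    combinations⇒All []              _      = []
    combinations⇒All {suc k} (b ∷ B) all∈X =
        subst (_∈ₛ X) (trans (cong₂ _+ᵥ_ (⊙-identityˡ b) (lincomb-𝟎 B)) (⊕-identityʳ b)) (all∈X (1# ∷ 𝟎 k))
      ∷ combinations⇒All B (λ cs →
          subst (_∈ₛ X) (trans (cong (_+ᵥ _) (⊙-zeroˡ b)) (⊕-identityˡ _)) (all∈X (0# ∷ cs)))

  []-independent : Independent []
  []-independent [] _ = refl

  ∷-independent : ∀ {k} {C : Vec V k} v → Independent C → ¬ InSpan C v → Independent (v ∷ C)
  ∷-independent {C = C} v C-indep v∉C (c ∷ cs) e with c ≟ᶠ 0#
  ... | yes refl = cong (0# ∷_) (C-indep cs (trans (sym (trans (cong (_+ᵥ _) (⊙-zeroˡ v)) (⊕-identityˡ _))) e))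
  ... | no c≢0 with d , c*d≡1 ← inverse c c≢0 = ⊥-elim (v∉C (⊖ (d ⊙ cs) , v≡))
    where
    v≡ : lincomb (⊖ (d ⊙ cs)) C ≡ v
    v≡ = begin
      lincomb (⊖ (d ⊙ cs)) C   ≡⟨ lincomb-⊖ (d ⊙ cs) C ⟩
      -ᵥ lincomb (d ⊙ cs) C    ≡⟨ cong -ᵥ_ (lincomb-⊙ d cs C) ⟩
      -ᵥ (d · lincomb cs C)    ≡⟨ cong (λ w → -ᵥ (d · w)) (⊖-unique (c · v) (lincomb cs C) e) ⟩
      -ᵥ (d · (-ᵥ (c · v)))    ≡⟨ cong -ᵥ_ (⊙-⊖-comm d (c · v)) ⟩
      -ᵥ (-ᵥ (d · (c · v)))    ≡⟨ ⊖-involutive _ ⟩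
      d · (c · v)              ≡⟨ ⊙-assoc d c v ⟨
      (d * c) · v              ≡⟨ cong (_· v) (trans (*-comm d c) c*d≡1) ⟩
      1# · v                   ≡⟨ ⊙-identityˡ v ⟩
      v                        ∎

  lincomb-injective : ∀ {k} {B : Vec V k} → Independent B → Injective _≡_ _≡_ (λ cs → lincomb cs B)
  lincomb-injective {B = B} B-indep {cs} {ds} e = x⊕⊖y≡𝟎⇒x≡y cs ds (B-indep _ (begin
    lincomb (cs ⊕ ⊖ ds) B             ≡⟨ lincomb-⊕ cs (⊖ ds) B ⟩
    lincomb cs B +ᵥ lincomb (⊖ ds) B  ≡⟨ cong₂ _+ᵥ_ e (lincomb-⊖ ds B) ⟩
    lincomb ds B +ᵥ (-ᵥ lincomb ds B) ≡⟨ ⊕-inverseʳ _ ⟩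
    0v                                ∎))

  1<q : 1 < q
  1<q = two-elements 0# 1# 0≢1
    where
    two-elements : ∀ {m} (a b : Fin m) → a ≢ b → 1 < m
    two-elements {suc zero}    Fin.zero Fin.zero a≢b = ⊥-elim (a≢b refl)
    two-elements {suc (suc _)} _        _        _   = ℕ.s≤s (ℕ.s≤s ℕ.z≤n)

  independent⇒length≤ : ∀ {k} {B : Vec V k} → Independent B → k ≤ n
  independent⇒length≤ B-indep = injective⇒length≤ 1<q _ (lincomb-injective B-indep)

  independent⊆span⇒length≤ : ∀ {k m} {B : Vec V k} (W : Vec V m) → Independent B
                           → (∀ cs → InSpan W (lincomb cs B)) → k ≤ m
  independent⊆span⇒length≤ {B = B} W B-indep B⊆W = injective⇒length≤ 1<q (proj₁ ∘ B⊆W) λ {cs} {ds} e →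
    lincomb-injective B-indep (trans (sym (proj₂ (B⊆W cs))) (trans (cong (λ es → lincomb es W) e) (proj₂ (B⊆W ds))))

  dim-unique : ∀ {X k m} → HasDim X k → HasDim X m → k ≡ m
  dim-unique (B , B-indep , B-spans) (W , W-indep , W-spans) =
    ℕ.≤-antisym (independent⊆span⇒length≤ W B-indep (transfer B-spans W-spans))
                (independent⊆span⇒length≤ B W-indep (transfer W-spans B-spans))
    where
    transfer : ∀ {X k m} {B : Vec V k} {W : Vec V m} → Spans X B → Spans X W → ∀ cs → InSpan W (lincomb cs B)
    transfer B-spans W-spans cs = Equivalence.to (W-spans _) (Equivalence.from (B-spans _) (cs , refl))

  -- Greedy extension: adjoin any vector of X outside the current span. Since independent families
  -- have length at most n, the invariant on the fuel makes the fuel-less case impossible.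
  extend : ∀ {X} → IsSubspace X → ∀ {k} (B : Vec V k) fuel {j} (A : Vec V j) → n < fuel ℕ.+ (j ℕ.+ k)
         → Independent (A ++ B) → All (_∈ₛ X) (A ++ B) → ∃₂ λ j (A : Vec V j) → IsBasis X (A ++ B)
  extend {X} sX B fuel A n<fuel+j+k A++B-indep A++B⊆X with find outside? (allVecs q n)
    where
    outside? : ∀ v → Dec (v ∈ₛ X × ¬ InSpan (A ++ B) v)
    outside? v = (member X v ≟ᵇ true) ×-dec ¬? (inSpan? (A ++ B) v)
  ... | inj₂ none = _ , A , A++B-indep , λ v → mk⇔ (spanned v) λ { (cs , refl) → lincomb-∈ sX A++B⊆X cs }
    where
    spanned : ∀ v → v ∈ₛ X → InSpan (A ++ B) v
    spanned v v∈X with inSpan? (A ++ B) v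
    ... | yes v∈span = v∈span
    ... | no  v∉span = ⊥-elim (none (∈-allVecs v) (v∈X , v∉span))
  extend sX B zero       A n<j+k A++B-indep _       | inj₁ _ =
    ⊥-elim (ℕ.<⇒≱ n<j+k (independent⇒length≤ A++B-indep))
  extend sX B (suc fuel) {j} A n<fuel+j+k A++B-indep A++B⊆X | inj₁ (v , v∈X , v∉span) =
    extend sX B fuel (v ∷ A) (subst (n <_) (sym (ℕ.+-suc fuel (j ℕ.+ _))) n<fuel+j+k)
      (∷-independent v A++B-indep v∉span) (v∈X ∷ A++B⊆X)

  extend-to-basis : ∀ {X k} {B : Vec V k} → IsSubspace X → Independent B → All (_∈ₛ X) B
                  → ∃₂ λ j (A : Vec V j) → IsBasis X (A ++ B)
  extend-to-basis {k = k} {B} sX = extend sX B (suc n) [] (ℕ.≤-trans (ℕ.n<1+n n) (ℕ.m≤m+n (suc n) k))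

  dim-exists : ∀ {X} → IsSubspace X → ∃ (HasDim X)
  dim-exists sX with j , A , A-basis ← extend-to-basis {B = []} sX []-independent [] =
    _ , A ++ [] , A-basis


  All-mono : ∀ {X Y k} {B : Vec V k} → X ⊆ Y → All (_∈ₛ X) B → All (_∈ₛ Y) B
  All-mono X⊆Y = All.map (X⊆Y _)

  dim-mono : ∀ {X Y k m} → IsSubspace Y → X ⊆ Y → HasDim X k → HasDim Y m → k ≤ m
  dim-mono {k = k} sY X⊆Y (B , B-indep , B-spans) Y-dim
    with j , A , A++B-basis ← extend-to-basis sY B-indep (All-mono X⊆Y (spans⇒All B B-spans))
    = subst (k ≤_) (dim-unique (_ , A++B-basis) Y-dim) (ℕ.m≤n+m k j)

  ⊆∧dim≡⇒≡ : ∀ {X Y k} → IsSubspace Y → X ⊆ Y → HasDim X k → HasDim Y k → X ≡ Y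
  ⊆∧dim≡⇒≡ {X} {Y} {k} sY X⊆Y (B , B-indep , B-spans) Y-dim
    with j , A , A++B-basis@(_ , A++B-spans) ← extend-to-basis sY B-indep (All-mono X⊆Y (spans⇒All B B-spans))
    = ⊆-antisym X⊆Y λ v v∈Y →
        Equivalence.from (B-spans v)
          (Equivalence.to (no-extension A (dim-unique (_ , A++B-basis) Y-dim) A++B-spans v) v∈Y)
    where
    no-extension : ∀ {j} (A : Vec V j) → j ℕ.+ k ≡ k → Spans Y (A ++ B) → Spans Y B
    no-extension []      _ A++B-spans = A++B-spans
    no-extension (_ ∷ A) e _          = ⊥-elim (ℕ.m≢1+n+m k (sym e))

  dim-zeroSp : HasDim zeroSp 0
  dim-zeroSp = [] , []-independent , λ v →
    mk⇔ (λ v∈0 → [] , sym (∈-zeroSp⁻ v v∈0)) (λ { ([] , refl) → 0v∈zeroSp })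

  dim≡0⇒≡zeroSp : ∀ {X} → HasDim X 0 → X ≡ zeroSp
  dim≡0⇒≡zeroSp {X} ([] , _ , []-spans) = ⊆-antisym only-0v
    λ v v∈0 → subst (_∈ₛ X) (sym (∈-zeroSp⁻ v v∈0)) (Equivalence.from ([]-spans 0v) ([] , refl))
    where
    only-0v : X ⊆ zeroSp
    only-0v v v∈X with [] , refl ← Equivalence.to ([]-spans v) v∈X = 0v∈zeroSp

  dim-fullSp : HasDim fullSp n
  dim-fullSp with m , fullSp-dim@(B , B-indep , B-spans) ← dim-exists fullSp-isSubspace =
    subst (HasDim fullSp) (ℕ.≤-antisym (independent⇒length≤ B-indep) n≤m) fullSp-dim
    where
    coordinates : ∀ v → InSpan B v
    coordinates v = Equivalence.to (B-spans v) (∈-fullSp v)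
    n≤m : n ≤ m
    n≤m = injective⇒length≤ 1<q (proj₁ ∘ coordinates) λ {u} {v} e →
      trans (sym (proj₂ (coordinates u))) (trans (cong (λ cs → lincomb cs B) e) (proj₂ (coordinates v)))

  dim≡n⇒≡fullSp : ∀ {X} → HasDim X n → X ≡ fullSp
  dim≡n⇒≡fullSp X-dim = ⊆∧dim≡⇒≡ fullSp-isSubspace (λ v _ → ∈-fullSp v) X-dim dim-fullSp

  lincomb-++-++ : ∀ {a b i} (α : Vec (Fin q) a) (β : Vec (Fin q) b) (γ : Vec (Fin q) i) A B C
                → lincomb (α ++ (β ++ γ)) (A ++ (B ++ C)) ≡ lincomb α A +ᵥ (lincomb β B +ᵥ lincomb γ C)
  lincomb-++-++ α β γ A B C = trans (lincomb-++ α (β ++ γ) A (B ++ C)) (cong (lincomb α A +ᵥ_) (lincomb-++ β γ B C))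

  module _ {X Y} (sX : IsSubspace X) (sY : IsSubspace Y) {a b i} {A : Vec V a} {B : Vec V b} {C : Vec V i}
           (C-spans : Spans (X ∩ Y) C) (AC-basis : IsBasis X (A ++ C)) (BC-basis : IsBasis Y (B ++ C)) where

    private
      AC⊆X : All (_∈ₛ X) (A ++ C)
      AC⊆X = spans⇒All (A ++ C) (proj₂ AC-basis)

      B⊆Y : All (_∈ₛ Y) B
      B⊆Y = ++ˡ⁻ B (spans⇒All (B ++ C) (proj₂ BC-basis))

      regroup : ∀ (x y z : V) → x +ᵥ (y +ᵥ z) ≡ (x +ᵥ z) +ᵥ y
      regroup x y z = trans (cong (x +ᵥ_) (⊕-comm y z)) (sym (⊕-assoc x z y))

    union-independent : Independent (A ++ (B ++ C))
    union-independent cs e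
      with α , βγ , refl ← splitAt a cs
      with β , γ , refl ← splitAt b βγ
      = begin
        α ++ (β ++ γ)            ≡⟨ cong₂ (λ α′ γ′ → α′ ++ (β ++ γ′))
                                           (++-injectiveˡ α (𝟎 a) αγ≡𝟎) (++-injectiveʳ α (𝟎 a) αγ≡𝟎) ⟩
        𝟎 a ++ (β ++ 𝟎 i)        ≡⟨ cong (λ β′ → 𝟎 a ++ (β′ ++ 𝟎 i)) β≡𝟎 ⟩
        𝟎 a ++ (𝟎 b ++ 𝟎 i)      ≡⟨ trans (𝟎-++ a _) (cong (𝟎 a ++_) (𝟎-++ b i)) ⟨
        𝟎 (a ℕ.+ (b ℕ.+ i))      ∎
      where
      lA = lincomb α A
      lB = lincomb β B
      lC = lincomb γ C
      lAC≡ : lincomb (α ++ γ) (A ++ C) ≡ lA +ᵥ lC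
      lAC≡ = lincomb-++ α γ A C
      sum≡0 : (lA +ᵥ lC) +ᵥ lB ≡ 0v
      sum≡0 = trans (sym (regroup lA lB lC)) (trans (sym (lincomb-++-++ α β γ A B C)) e)
      -- lB = -(lA + lC) lies in X as well as in Y, so it is a combination of C.
      lB∈X∩Y : lB ∈ₛ (X ∩ Y)
      lB∈X∩Y = ∈-∩⁺ lB (subst (_∈ₛ X) (sym (⊖-unique _ _ sum≡0))
                          (-ᵥ-∈ sX (subst (_∈ₛ X) lAC≡ (lincomb-∈ sX AC⊆X (α ++ γ)))))
                       (lincomb-∈ sY B⊆Y β)
      δ = proj₁ (Equivalence.to (C-spans lB) lB∈X∩Y)
      β≡𝟎 : β ≡ 𝟎 b
      β≡𝟎 = ++-injectiveˡ β (𝟎 b) (trans (proj₁ BC-basis (β ++ ⊖ δ) (begin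
        lincomb (β ++ ⊖ δ) (B ++ C)    ≡⟨ lincomb-++ β (⊖ δ) B C ⟩
        lB +ᵥ lincomb (⊖ δ) C          ≡⟨ cong (lB +ᵥ_) (lincomb-⊖ δ C) ⟩
        lB +ᵥ (-ᵥ lincomb δ C)         ≡⟨ cong (λ w → lB +ᵥ (-ᵥ w)) (proj₂ (Equivalence.to (C-spans lB) lB∈X∩Y)) ⟩
        lB +ᵥ (-ᵥ lB)                  ≡⟨ ⊕-inverseʳ lB ⟩
        0v                             ∎)) (𝟎-++ b i))
      αγ≡𝟎 : α ++ γ ≡ 𝟎 a ++ 𝟎 i
      αγ≡𝟎 = trans (proj₁ AC-basis (α ++ γ) (begin
        lincomb (α ++ γ) (A ++ C)      ≡⟨ lAC≡ ⟩
        lA +ᵥ lC                       ≡⟨ ⊕-identityʳ _ ⟨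
        (lA +ᵥ lC) +ᵥ 0v               ≡⟨ cong ((lA +ᵥ lC) +ᵥ_)
                                                  (trans (cong (λ β′ → lincomb β′ B) β≡𝟎) (lincomb-𝟎 B)) ⟨
        (lA +ᵥ lC) +ᵥ lB               ≡⟨ sum≡0 ⟩
        0v                             ∎)) (𝟎-++ a i)

    union-spans : Spans (X ⊹ Y) (A ++ (B ++ C))
    union-spans v = mk⇔ to from
      where
      to : v ∈ₛ (X ⊹ Y) → InSpan (A ++ (B ++ C)) v
      to v∈
        with x , y , x∈X , y∈Y , refl ← ∈-⊹⁻ v v∈
        with cs , refl ← Equivalence.to (proj₂ AC-basis x) x∈X
        with ds , refl ← Equivalence.to (proj₂ BC-basis y) y∈Y
        with α , γ , refl ← splitAt a cs
        with β , γ′ , refl ← splitAt b ds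
        = α ++ (β ++ (γ ⊕ γ′)) , (begin
          lincomb (α ++ (β ++ (γ ⊕ γ′))) (A ++ (B ++ C))
            ≡⟨ lincomb-++-++ α β (γ ⊕ γ′) A B C ⟩
          lincomb α A +ᵥ (lincomb β B +ᵥ lincomb (γ ⊕ γ′) C)
            ≡⟨ cong (λ w → lincomb α A +ᵥ (lincomb β B +ᵥ w)) (lincomb-⊕ γ γ′ C) ⟩
          lincomb α A +ᵥ (lincomb β B +ᵥ (lincomb γ C +ᵥ lincomb γ′ C))
            ≡⟨ ⊕-assoc _ _ _ ⟨
          (lincomb α A +ᵥ lincomb β B) +ᵥ (lincomb γ C +ᵥ lincomb γ′ C)
            ≡⟨ ⊕-interchange _ _ _ _ ⟩
          (lincomb α A +ᵥ lincomb γ C) +ᵥ (lincomb β B +ᵥ lincomb γ′ C)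
            ≡⟨ cong₂ _+ᵥ_ (lincomb-++ α γ A C) (lincomb-++ β γ′ B C) ⟨
          lincomb (α ++ γ) (A ++ C) +ᵥ lincomb (β ++ γ′) (B ++ C) ∎)
      from : InSpan (A ++ (B ++ C)) v → v ∈ₛ (X ⊹ Y)
      from (cs , refl)
        with α , βγ , refl ← splitAt a cs
        with β , γ , refl ← splitAt b βγ
        = subst (_∈ₛ (X ⊹ Y)) (sym (trans (lincomb-++-++ α β γ A B C) (regroup _ _ _)))
            (∈-⊹⁺ _ _ (subst (_∈ₛ X) (lincomb-++ α γ A C) (lincomb-∈ sX AC⊆X (α ++ γ))) (lincomb-∈ sY B⊆Y β))

  grassmann : ∀ {X Y} → IsSubspace X → IsSubspace Y → ∀ {x y s i}
            → HasDim X x → HasDim Y y → HasDim (X ⊹ Y) s → HasDim (X ∩ Y) i → s ℕ.+ i ≡ x ℕ.+ y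
  grassmann sX sY {i = i} X-dim Y-dim X⊹Y-dim (C , C-indep , C-spans)
    with a , A , AC-basis ← extend-to-basis sX C-indep (All-mono ∩⊆ˡ (spans⇒All C C-spans))
    with b , B , BC-basis ← extend-to-basis sY C-indep (All-mono ∩⊆ʳ (spans⇒All C C-spans))
    rewrite dim-unique X-dim (_ , AC-basis)
          | dim-unique Y-dim (_ , BC-basis)
          | dim-unique X⊹Y-dim (_ , union-independent sX sY C-spans AC-basis BC-basis ,
                                    union-spans sX sY C-spans AC-basis BC-basis)
    = begin
      (a ℕ.+ (b ℕ.+ i)) ℕ.+ i   ≡⟨ ℕ.+-assoc a _ i ⟩
      a ℕ.+ ((b ℕ.+ i) ℕ.+ i)   ≡⟨ cong (a ℕ.+_) (ℕ.+-comm (b ℕ.+ i) i) ⟩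
      a ℕ.+ (i ℕ.+ (b ℕ.+ i))   ≡⟨ ℕ.+-assoc a i _ ⟨
      (a ℕ.+ i) ℕ.+ (b ℕ.+ i)   ∎

  HasDim-subst : ∀ {X Y k} → X ≡ Y → HasDim X k → HasDim Y k
  HasDim-subst {k = k} = subst (λ Z → HasDim Z k)

  sameDist⇒ : ∀ {X Y Z W} → IsSubspace X → IsSubspace Y → IsSubspace Z → IsSubspace W → SameDist X Y Z W
            → ∀ {a b c d} → HasDim (X ⊹ Y) a → HasDim (X ∩ Y) b → HasDim (Z ⊹ W) c → HasDim (Z ∩ W) d
            → a ℕ.+ d ≡ c ℕ.+ b
  sameDist⇒ sX sY sZ sW X-Y~Z-W a-dim b-dim c-dim d-dim =
    ∸≡∸⇒+≡+ (dim-mono (⊹-isSubspace sX sY) (∩⊆⊹ sY) b-dim a-dim)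
             (dim-mono (⊹-isSubspace sZ sW) (∩⊆⊹ sW) d-dim c-dim)
             (X-Y~Z-W _ _ _ _ a-dim b-dim c-dim d-dim)

  opaque
    dim : ∀ {X} → IsSubspace X → ℕ
    dim sX = proj₁ (dim-exists sX)

    dim-spec : ∀ {X} (sX : IsSubspace X) → HasDim X (dim sX)
    dim-spec sX = proj₂ (dim-exists sX)

  dim-⊹-disjoint : ∀ {X Y a b c} → IsSubspace X → IsSubspace Y → X ∩ Y ≡ zeroSp
                 → HasDim X a → HasDim Y b → HasDim (X ⊹ Y) c → c ≡ a ℕ.+ b
  dim-⊹-disjoint sX sY X∩Y≡0 X-dim Y-dim X⊹Y-dim =
    trans (sym (ℕ.+-identityʳ _)) (grassmann sX sY X-dim Y-dim X⊹Y-dim (HasDim-subst (sym X∩Y≡0) dim-zeroSp))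

module LinearCode⇒Complemented {q : ℕ} (F : FiniteField q) {n : ℕ} (U : Sub.Family F {n})
  (U-sub : Sub.InProjSpace F U) (U-code : Sub.IsLinearCode F U)
  (∩-closed : Sub.ClosedUnderIntersection F U) (fullSp∈U : U (Sub.fullSp F)) where
  open Sub F {n}
  open Subspaces F {n}
  open Dimension F {n}

  zeroSp∈U : U zeroSp
  zeroSp∈U = proj₁ U-code

  _⊞_ : VSet q n → VSet q n → VSet q n
  _⊞_ = proj₁ (proj₂ U-code)

  ⊞-closed : ∀ X Y → U X → U Y → U (X ⊞ Y)
  ⊞-closed = proj₁ (proj₂ (proj₂ U-code))

  ⊞-assoc : ∀ X Y Z → U X → U Y → U Z → (X ⊞ Y) ⊞ Z ≡ X ⊞ (Y ⊞ Z)
  ⊞-assoc = proj₁ (proj₂ (proj₂ (proj₂ U-code)))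

  ⊞-comm : ∀ X Y → U X → U Y → X ⊞ Y ≡ Y ⊞ X
  ⊞-comm = proj₁ (proj₂ (proj₂ (proj₂ (proj₂ U-code))))

  ⊞-identityʳ : ∀ X → U X → X ⊞ zeroSp ≡ X
  ⊞-identityʳ = proj₁ (proj₂ (proj₂ (proj₂ (proj₂ (proj₂ U-code)))))

  ⊞-self : ∀ X → U X → X ⊞ X ≡ zeroSp
  ⊞-self = proj₁ (proj₂ (proj₂ (proj₂ (proj₂ (proj₂ (proj₂ U-code))))))

  ⊞-isometry : ∀ X Y W → U X → U Y → U W → SameDist X Y (X ⊞ W) (Y ⊞ W)
  ⊞-isometry = proj₂ (proj₂ (proj₂ (proj₂ (proj₂ (proj₂ (proj₂ U-code))))))

  ⊞-identityˡ : ∀ {X} → U X → zeroSp ⊞ X ≡ X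
  ⊞-identityˡ {X} uX = trans (⊞-comm _ _ zeroSp∈U uX) (⊞-identityʳ X uX)

  sub : ∀ {X} → U X → IsSubspace X
  sub = U-sub _

  ∁ : VSet q n → VSet q n
  ∁ X = X ⊞ fullSp

  ∁-closed : ∀ {X} → U X → U (∁ X)
  ∁-closed uX = ⊞-closed _ fullSp uX fullSp∈U

  ∁-sub : ∀ {X} → U X → IsSubspace (∁ X)
  ∁-sub = sub ∘ ∁-closed

  ∁-involutive : ∀ {X} → U X → ∁ (∁ X) ≡ X
  ∁-involutive {X} uX = begin
    (X ⊞ fullSp) ⊞ fullSp    ≡⟨ ⊞-assoc X fullSp fullSp uX fullSp∈U fullSp∈U ⟩
    X ⊞ (fullSp ⊞ fullSp)    ≡⟨ cong (X ⊞_) (⊞-self fullSp fullSp∈U) ⟩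
    X ⊞ zeroSp               ≡⟨ ⊞-identityʳ X uX ⟩
    X                        ∎

  ∁-⊞-self : ∀ {Y} → U Y → ∁ Y ⊞ Y ≡ fullSp
  ∁-⊞-self {Y} uY = begin
    (Y ⊞ fullSp) ⊞ Y    ≡⟨ ⊞-assoc Y fullSp Y uY fullSp∈U uY ⟩
    Y ⊞ (fullSp ⊞ Y)    ≡⟨ cong (Y ⊞_) (⊞-comm fullSp Y fullSp∈U uY) ⟩
    Y ⊞ (Y ⊞ fullSp)    ≡⟨ ⊞-assoc Y Y fullSp uY uY fullSp∈U ⟨
    (Y ⊞ Y) ⊞ fullSp    ≡⟨ cong (_⊞ fullSp) (⊞-self Y uY) ⟩
    zeroSp ⊞ fullSp     ≡⟨ ⊞-identityˡ fullSp∈U ⟩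
    fullSp              ∎

  dim-∁ : ∀ {X k m} → U X → HasDim X k → HasDim (∁ X) m → k ℕ.+ m ≡ n
  dim-∁ {X} uX X-dim ∁X-dim = trans
    (sameDist⇒ (sub uX) zeroSp-isSubspace (∁-sub uX) fullSp-isSubspace X-0~∁X-F
      (HasDim-subst (sym (⊹-identityʳ X)) X-dim) (HasDim-subst (sym (∩-zeroʳ (sub uX))) dim-zeroSp)
      (HasDim-subst (sym (⊹-zeroʳ (∁-sub uX))) dim-fullSp) (HasDim-subst (sym (∩-identityʳ (∁ X))) ∁X-dim))
    (ℕ.+-identityʳ n)
    where
    X-0~∁X-F : SameDist X zeroSp (∁ X) fullSp
    X-0~∁X-F = subst (SameDist X zeroSp (∁ X)) (⊞-identityˡ fullSp∈U)
                     (⊞-isometry X zeroSp fullSp uX zeroSp∈U fullSp∈U)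

  ∁-complement : ∀ {X} → U X → X ∩ ∁ X ≡ zeroSp × X ⊹ ∁ X ≡ fullSp
  ∁-complement {X} uX = dim≡0⇒≡zeroSp (subst (HasDim _) i≡0 i-dim) , dim≡n⇒≡fullSp (subst (HasDim _) s≡n s-dim)
    where
    sX = sub uX
    s∁X = ∁-sub uX
    i = dim (∩-isSubspace sX s∁X)
    i-dim = dim-spec (∩-isSubspace sX s∁X)
    s = dim (⊹-isSubspace sX s∁X)
    s-dim = dim-spec (⊹-isSubspace sX s∁X)
    0-F~X-∁X : SameDist zeroSp fullSp X (∁ X)
    0-F~X-∁X = subst₂ (SameDist zeroSp fullSp) (⊞-identityˡ uX) (⊞-comm fullSp X fullSp∈U uX)
                      (⊞-isometry zeroSp fullSp X zeroSp∈U fullSp∈U uX)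
    n+i≡s : n ℕ.+ i ≡ s
    n+i≡s = trans (sameDist⇒ zeroSp-isSubspace fullSp-isSubspace sX s∁X 0-F~X-∁X
                    (HasDim-subst (sym (⊹-identityˡ fullSp)) dim-fullSp)
                    (HasDim-subst (sym (∩-identityʳ zeroSp)) dim-zeroSp) s-dim i-dim)
                  (ℕ.+-identityʳ s)
    s+i≡n : s ℕ.+ i ≡ n
    s+i≡n = trans (grassmann sX s∁X (dim-spec sX) (dim-spec s∁X) s-dim i-dim) (dim-∁ uX (dim-spec sX) (dim-spec s∁X))
    i≡0 : i ≡ 0
    i≡0 = m+n≡o⇒o+n≡m⇒n≡0 n+i≡s s+i≡n
    s≡n : s ≡ n
    s≡n = trans (sym (ℕ.+-identityʳ s)) (trans (cong (s ℕ.+_) (sym i≡0)) s+i≡n)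

  dim-⊹+dim-∁∩∁ : ∀ {X Y s a} → U X → U Y → HasDim (X ⊹ Y) s → HasDim (∁ X ∩ ∁ Y) a → s ℕ.+ a ≡ n
  dim-⊹+dim-∁∩∁ {X} {Y} {s} {a} uX uY s-dim a-dim = m+m≡n+n⇒m≡n (begin
    (s ℕ.+ a) ℕ.+ (s ℕ.+ a)       ≡⟨ cong ((s ℕ.+ a) ℕ.+_) s+a≡t+i ⟩
    (s ℕ.+ a) ℕ.+ (t ℕ.+ i)       ≡⟨ cong ((s ℕ.+ a) ℕ.+_) (ℕ.+-comm t i) ⟩
    (s ℕ.+ a) ℕ.+ (i ℕ.+ t)       ≡⟨ +-interchange s a i t ⟩
    (s ℕ.+ i) ℕ.+ (a ℕ.+ t)       ≡⟨ cong ((s ℕ.+ i) ℕ.+_) (ℕ.+-comm a t) ⟩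
    (s ℕ.+ i) ℕ.+ (t ℕ.+ a)       ≡⟨ cong₂ ℕ._+_ (grassmann sX sY x-dim y-dim s-dim i-dim)
                                                  (grassmann s∁X s∁Y x′-dim y′-dim t-dim a-dim) ⟩
    (x ℕ.+ y) ℕ.+ (x′ ℕ.+ y′)     ≡⟨ +-interchange x y x′ y′ ⟩
    (x ℕ.+ x′) ℕ.+ (y ℕ.+ y′)     ≡⟨ cong₂ ℕ._+_ (dim-∁ uX x-dim x′-dim) (dim-∁ uY y-dim y′-dim) ⟩
    n ℕ.+ n                       ∎)
    where
    sX = sub uX
    sY = sub uY
    s∁X = ∁-sub uX
    s∁Y = ∁-sub uY
    x = dim sX
    x-dim = dim-spec sX
    y = dim sY
    y-dim = dim-spec sY
    x′ = dim s∁X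
    x′-dim = dim-spec s∁X
    y′ = dim s∁Y
    y′-dim = dim-spec s∁Y
    i = dim (∩-isSubspace sX sY)
    i-dim = dim-spec (∩-isSubspace sX sY)
    t = dim (⊹-isSubspace s∁X s∁Y)
    t-dim = dim-spec (⊹-isSubspace s∁X s∁Y)
    s+a≡t+i : s ℕ.+ a ≡ t ℕ.+ i
    s+a≡t+i = sameDist⇒ sX sY s∁X s∁Y (⊞-isometry X Y fullSp uX uY fullSp∈U) s-dim i-dim t-dim a-dim

  ∁-antitone : ∀ {Z W} → U Z → U W → Z ⊆ W → ∁ W ⊆ ∁ Z
  ∁-antitone {Z} {W} uZ uW Z⊆W = subst (∁ W ⊆_) (sym ∁Z≡∁Z⊹∁W) (⊆-⊹ʳ (∁-sub uZ))
    where
    z-dim = dim-spec (sub uZ)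
    m = dim (∁-sub uZ)
    m-dim = dim-spec (∁-sub uZ)
    c = dim (⊹-isSubspace (∁-sub uZ) (∁-sub uW))
    c-dim = dim-spec (⊹-isSubspace (∁-sub uZ) (∁-sub uW))
    ∁∁Z∩∁∁W≡Z : ∁ (∁ Z) ∩ ∁ (∁ W) ≡ Z
    ∁∁Z∩∁∁W≡Z = trans (cong₂ _∩_ (∁-involutive uZ) (∁-involutive uW)) (⊆⇒∩≡ˡ Z⊆W)
    c≡m : c ≡ m
    c≡m = ℕ.+-cancelʳ-≡ (dim (sub uZ)) c m (trans
      (dim-⊹+dim-∁∩∁ (∁-closed uZ) (∁-closed uW) c-dim (HasDim-subst (sym ∁∁Z∩∁∁W≡Z) z-dim))
      (sym (trans (ℕ.+-comm m _) (dim-∁ uZ z-dim m-dim))))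
    ∁Z≡∁Z⊹∁W : ∁ Z ≡ ∁ Z ⊹ ∁ W
    ∁Z≡∁Z⊹∁W = ⊆∧dim≡⇒≡ (⊹-isSubspace (∁-sub uZ) (∁-sub uW)) (⊆-⊹ˡ (∁-sub uW))
                         m-dim (subst (HasDim _) c≡m c-dim)

  ⊹≡∁[∁∩∁] : ∀ {X Y} → U X → U Y → X ⊹ Y ≡ ∁ (∁ X ∩ ∁ Y)
  ⊹≡∁[∁∩∁] {X} {Y} uX uY =
    ⊆∧dim≡⇒≡ (∁-sub uM) (⊹-least (∁-sub uM) X⊆∁M Y⊆∁M) s-dim (subst (HasDim _) (sym s≡j) j-dim)
    where
    uM = ∩-closed _ _ (∁-closed uX) (∁-closed uY)
    a = dim (sub uM)
    a-dim = dim-spec (sub uM)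
    j = dim (∁-sub uM)
    j-dim = dim-spec (∁-sub uM)
    s = dim (⊹-isSubspace (sub uX) (sub uY))
    s-dim = dim-spec (⊹-isSubspace (sub uX) (sub uY))
    X⊆∁M : X ⊆ ∁ (∁ X ∩ ∁ Y)
    X⊆∁M = subst (_⊆ ∁ (∁ X ∩ ∁ Y)) (∁-involutive uX) (∁-antitone uM (∁-closed uX) ∩⊆ˡ)
    Y⊆∁M : Y ⊆ ∁ (∁ X ∩ ∁ Y)
    Y⊆∁M = subst (_⊆ ∁ (∁ X ∩ ∁ Y)) (∁-involutive uY) (∁-antitone uM (∁-closed uY) ∩⊆ʳ)
    s≡j : s ≡ j
    s≡j = ℕ.+-cancelʳ-≡ a s j (trans (dim-⊹+dim-∁∩∁ uX uY s-dim a-dim)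
                                       (sym (trans (ℕ.+-comm j a) (dim-∁ uM a-dim j-dim))))

  ⊹-closed : ∀ X Y → U X → U Y → U (X ⊹ Y)
  ⊹-closed X Y uX uY = subst U (sym (⊹≡∁[∁∩∁] uX uY)) (∁-closed (∩-closed _ _ (∁-closed uX) (∁-closed uY)))

  -- With E = X ⊞ Y, isometry gives d(X,Y) = d(E,0) = dim E and d(X,∁Y) = d(E,𝔽ⁿ) = n - dim E,
  -- so d(X,Y) + d(X,∁Y) = n; by Grassmann this says dim X = dim (X ∩ Y) + dim (X ∩ ∁Y).
  dim-∩+dim-∩∁ : ∀ {X Y} (uX : U X) (uY : U Y)
               → dim (sub uX) ≡ dim (∩-isSubspace (sub uX) (sub uY)) ℕ.+ dim (∩-isSubspace (sub uX) (∁-sub uY))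
  dim-∩+dim-∩∁ {X} {Y} uX uY = m+m≡n+n⇒m≡n (ℕ.+-cancelʳ-≡ n _ _ (begin
    (x ℕ.+ x) ℕ.+ n                           ≡⟨ cong ((x ℕ.+ x) ℕ.+_) (dim-∁ uY y-dim y′-dim) ⟨
    (x ℕ.+ x) ℕ.+ (y ℕ.+ y′)                  ≡⟨ +-interchange x x y y′ ⟩
    (x ℕ.+ y) ℕ.+ (x ℕ.+ y′)                  ≡⟨ cong₂ ℕ._+_ (grassmann sX sY x-dim y-dim s-dim i-dim)
                                                            (grassmann sX s∁Y x-dim y′-dim s′-dim p-dim) ⟨
    (s ℕ.+ i) ℕ.+ (s′ ℕ.+ p)                  ≡⟨ cong (λ z → (z ℕ.+ i) ℕ.+ (s′ ℕ.+ p)) s≡e+i ⟩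
    ((e ℕ.+ i) ℕ.+ i) ℕ.+ (s′ ℕ.+ p)          ≡⟨ solve 4 (λ e i s′ p → ((e :+ i) :+ i) :+ (s′ :+ p)
                                                                  := (s′ :+ e) :+ (p :+ (i :+ i))) refl e i s′ p ⟩
    (s′ ℕ.+ e) ℕ.+ (p ℕ.+ (i ℕ.+ i))          ≡⟨ cong (ℕ._+ (p ℕ.+ (i ℕ.+ i))) s′+e≡n+p ⟩
    (n ℕ.+ p) ℕ.+ (p ℕ.+ (i ℕ.+ i))           ≡⟨ solve 3 (λ n p i → (n :+ p) :+ (p :+ (i :+ i))
                                                                  := ((i :+ p) :+ (i :+ p)) :+ n) refl n p i ⟩
    ((i ℕ.+ p) ℕ.+ (i ℕ.+ p)) ℕ.+ n           ∎))
    where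
    open +-*-Solver
    sX = sub uX
    sY = sub uY
    s∁Y = ∁-sub uY
    uE = ⊞-closed X Y uX uY
    x = dim sX
    x-dim = dim-spec sX
    y-dim = dim-spec sY
    y = dim sY
    y′ = dim s∁Y
    y′-dim = dim-spec s∁Y
    e = dim (sub uE)
    e-dim = dim-spec (sub uE)
    s = dim (⊹-isSubspace sX sY)
    s-dim = dim-spec (⊹-isSubspace sX sY)
    i = dim (∩-isSubspace sX sY)
    i-dim = dim-spec (∩-isSubspace sX sY)
    s′ = dim (⊹-isSubspace sX s∁Y)
    s′-dim = dim-spec (⊹-isSubspace sX s∁Y)
    p = dim (∩-isSubspace sX s∁Y)
    p-dim = dim-spec (∩-isSubspace sX s∁Y)
    s≡e+i : s ≡ e ℕ.+ i
    s≡e+i = trans (sym (ℕ.+-identityʳ s)) (sameDist⇒ sX sY (sub uE) zeroSp-isSubspace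
      (subst (SameDist X Y (X ⊞ Y)) (⊞-self Y uY) (⊞-isometry X Y Y uX uY uY))
      s-dim i-dim (HasDim-subst (sym (⊹-identityʳ _)) e-dim) (HasDim-subst (sym (∩-zeroʳ (sub uE))) dim-zeroSp))
    s′+e≡n+p : s′ ℕ.+ e ≡ n ℕ.+ p
    s′+e≡n+p = sameDist⇒ sX s∁Y (sub uE) fullSp-isSubspace
      (subst (SameDist X (∁ Y) (X ⊞ Y)) (∁-⊞-self uY) (⊞-isometry X (∁ Y) Y uX (∁-closed uY) uY))
      s′-dim p-dim (HasDim-subst (sym (⊹-zeroʳ (sub uE))) dim-fullSp) (HasDim-subst (sym (∩-identityʳ _)) e-dim)

  split : ∀ {X Y} → U X → U Y → X ≡ (X ∩ Y) ⊹ (X ∩ ∁ Y)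
  split {X} {Y} uX uY = sym (⊆∧dim≡⇒≡ sX (⊹-least sX ∩⊆ˡ ∩⊆ˡ) (subst (HasDim _) t≡x t-dim) (dim-spec sX))
    where
    sX = sub uX
    sX∩Y = ∩-isSubspace sX (sub uY)
    sX∩∁Y = ∩-isSubspace sX (∁-sub uY)
    t-dim = dim-spec (⊹-isSubspace sX∩Y sX∩∁Y)
    disjoint-parts : (X ∩ Y) ∩ (X ∩ ∁ Y) ≡ zeroSp
    disjoint-parts = disjoint sX∩Y sX∩∁Y λ v v∈X∩Y v∈X∩∁Y →
      ∈-zeroSp⁻ v (subst (v ∈ₛ_) (proj₁ (∁-complement uY)) (∈-∩⁺ v (∩⊆ʳ v v∈X∩Y) (∩⊆ʳ v v∈X∩∁Y)))
    t≡x = trans (dim-⊹-disjoint sX∩Y sX∩∁Y disjoint-parts (dim-spec sX∩Y) (dim-spec sX∩∁Y) t-dim)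
                (sym (dim-∩+dim-∩∁ uX uY))

  ∩-distribˡ-⊹ : ∀ X Y Z → U X → U Y → U Z → X ∩ (Y ⊹ Z) ≡ (X ∩ Y) ⊹ (X ∩ Z)
  ∩-distribˡ-⊹ X Y Z uX uY uZ = ⊆-antisym
    (splitting⇒∩-⊹-⊆ (sub uX) (∁-sub uX) (proj₁ (∁-complement uX))
      (λ v → subst (v ∈ₛ_) (split uY uX)) (λ v → subst (v ∈ₛ_) (split uZ uX)))
    (∩-⊹-⊇ (sub uX))

  complemented-distributive : IsDistributiveSublattice U × HasComplement U
  complemented-distributive =
      ((fullSp , fullSp∈U) , ⊹-closed , ∩-closed , ∩-distribˡ-⊹)
    , ∁ , (λ _ → ∁-closed) , (λ _ → ∁-complement) , ∁-dim , (λ _ → ∁-involutive)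
    , (λ X Y uX uY → ⊞-isometry X Y fullSp uX uY fullSp∈U)
    where
    ∁-dim : ∀ k X → U X → HasDim X k → HasDim (∁ X) (n ∸ k)
    ∁-dim k X uX X-dim = subst (HasDim (∁ X)) m≡n∸k (dim-spec (∁-sub uX))
      where
      m≡n∸k : dim (∁-sub uX) ≡ n ∸ k
      m≡n∸k = trans (sym (ℕ.m+n∸m≡n k _)) (cong (_∸ k) (dim-∁ uX X-dim (dim-spec (∁-sub uX))))

module Complemented⇒LinearCode {q : ℕ} (F : FiniteField q) {n : ℕ} (U : Sub.Family F {n})
  (U-sub : Sub.InProjSpace F U) (U-lattice : Sub.IsDistributiveSublattice F U) (U-compl : Sub.HasComplement F U) where
  open Sub F {n}
  open Subspaces F {n}
  open Dimension F {n}

  ⊹-closed : ∀ X Y → U X → U Y → U (X ⊹ Y)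
  ⊹-closed = proj₁ (proj₂ U-lattice)

  ∩-closed : ∀ X Y → U X → U Y → U (X ∩ Y)
  ∩-closed = proj₁ (proj₂ (proj₂ U-lattice))

  ∩-distribˡ-⊹ : ∀ X Y Z → U X → U Y → U Z → X ∩ (Y ⊹ Z) ≡ (X ∩ Y) ⊹ (X ∩ Z)
  ∩-distribˡ-⊹ = proj₂ (proj₂ (proj₂ U-lattice))

  ∁ : VSet q n → VSet q n
  ∁ = proj₁ U-compl

  ∁-closed : ∀ {X} → U X → U (∁ X)
  ∁-closed = proj₁ (proj₂ U-compl) _

  ∁-complement : ∀ {X} → U X → X ∩ ∁ X ≡ zeroSp × X ⊹ ∁ X ≡ fullSp
  ∁-complement = proj₁ (proj₂ (proj₂ U-compl)) _

  sub : ∀ {X} → U X → IsSubspace X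
  sub = U-sub _

  zeroSp∈U : U zeroSp
  zeroSp∈U with X , uX ← proj₁ U-lattice = subst U (proj₁ (∁-complement uX)) (∩-closed _ _ uX (∁-closed uX))

  fullSp∈U : U fullSp
  fullSp∈U with X , uX ← proj₁ U-lattice = subst U (proj₂ (∁-complement uX)) (⊹-closed _ _ uX (∁-closed uX))

  ∩-distribʳ-⊹ : ∀ X Y Z → U X → U Y → U Z → (X ⊹ Y) ∩ Z ≡ (X ∩ Z) ⊹ (Y ∩ Z)
  ∩-distribʳ-⊹ X Y Z uX uY uZ = begin
    (X ⊹ Y) ∩ Z          ≡⟨ ∩-comm (X ⊹ Y) Z ⟩
    Z ∩ (X ⊹ Y)          ≡⟨ ∩-distribˡ-⊹ Z X Y uZ uX uY ⟩
    (Z ∩ X) ⊹ (Z ∩ Y)    ≡⟨ cong₂ _⊹_ (∩-comm Z X) (∩-comm Z Y) ⟩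
    (X ∩ Z) ⊹ (Y ∩ Z)    ∎

  split : ∀ {X Y} → U X → U Y → X ≡ (X ∩ Y) ⊹ (X ∩ ∁ Y)
  split {X} {Y} uX uY = begin
    X                      ≡⟨ ∩-identityʳ X ⟨
    X ∩ fullSp             ≡⟨ cong (X ∩_) (proj₂ (∁-complement uY)) ⟨
    X ∩ (Y ⊹ ∁ Y)          ≡⟨ ∩-distribˡ-⊹ X Y (∁ Y) uX uY (∁-closed uY) ⟩
    (X ∩ Y) ⊹ (X ∩ ∁ Y)    ∎

  private
    disjoint⇒⊆ : ∀ {A B C} → U A → U B → U C → A ∩ B ≡ zeroSp → A ⊹ C ≡ fullSp → B ≡ B ∩ C
    disjoint⇒⊆ {A} {B} {C} uA uB uC A∩B≡0 A⊹C≡F = begin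
      B                      ≡⟨ ∩-identityʳ B ⟨
      B ∩ fullSp             ≡⟨ cong (B ∩_) A⊹C≡F ⟨
      B ∩ (A ⊹ C)            ≡⟨ ∩-distribˡ-⊹ B A C uB uA uC ⟩
      (B ∩ A) ⊹ (B ∩ C)      ≡⟨ cong (_⊹ (B ∩ C)) (trans (∩-comm B A) A∩B≡0) ⟩
      zeroSp ⊹ (B ∩ C)       ≡⟨ ⊹-identityˡ (B ∩ C) ⟩
      B ∩ C                  ∎

  complement-unique : ∀ {A B C} → U A → U B → U C → A ∩ B ≡ zeroSp → A ⊹ B ≡ fullSp
                    → A ∩ C ≡ zeroSp → A ⊹ C ≡ fullSp → B ≡ C
  complement-unique uA uB uC A∩B≡0 A⊹B≡F A∩C≡0 A⊹C≡F =
    trans (disjoint⇒⊆ uA uB uC A∩B≡0 A⊹C≡F) (trans (∩-comm _ _) (sym (disjoint⇒⊆ uA uC uB A∩C≡0 A⊹B≡F)))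

  separated⇒disjoint : ∀ {Y A B} → U Y → IsSubspace A → IsSubspace B → A ⊆ Y → B ⊆ ∁ Y → A ∩ B ≡ zeroSp
  separated⇒disjoint uY sA sB A⊆Y B⊆∁Y = disjoint sA sB λ v v∈A v∈B →
    ∈-zeroSp⁻ v (subst (v ∈ₛ_) (proj₁ (∁-complement uY)) (∈-∩⁺ v (A⊆Y v v∈A) (B⊆∁Y v v∈B)))

  ⊹-disjointʳ : ∀ {A C D} → U A → U C → U D → A ∩ C ≡ zeroSp → A ∩ D ≡ zeroSp → A ∩ (C ⊹ D) ≡ zeroSp
  ⊹-disjointʳ uA uC uD A∩C≡0 A∩D≡0 =
    trans (∩-distribˡ-⊹ _ _ _ uA uC uD) (trans (cong₂ _⊹_ A∩C≡0 A∩D≡0) (⊹-identityʳ zeroSp))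

  ⊹-disjointˡ : ∀ {A B C} → U A → U B → U C → A ∩ C ≡ zeroSp → B ∩ C ≡ zeroSp → (A ⊹ B) ∩ C ≡ zeroSp
  ⊹-disjointˡ uA uB uC A∩C≡0 B∩C≡0 =
    trans (∩-distribʳ-⊹ _ _ _ uA uB uC) (trans (cong₂ _⊹_ A∩C≡0 B∩C≡0) (⊹-identityʳ zeroSp))

  infixl 6 _⊞_
  _⊞_ : VSet q n → VSet q n → VSet q n
  X ⊞ Y = (X ∩ ∁ Y) ⊹ (∁ X ∩ Y)

  ⊞-closed : ∀ X Y → U X → U Y → U (X ⊞ Y)
  ⊞-closed X Y uX uY = ⊹-closed _ _ (∩-closed _ _ uX (∁-closed uY)) (∩-closed _ _ (∁-closed uX) uY)

  ∁-⊞ : ∀ {X Y} → U X → U Y → ∁ (X ⊞ Y) ≡ (X ∩ Y) ⊹ (∁ X ∩ ∁ Y)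
  ∁-⊞ {X} {Y} uX uY =
    complement-unique uX⊞Y (∁-closed uX⊞Y) (⊹-closed _ _ uc ud)
      (proj₁ (∁-complement uX⊞Y)) (proj₂ (∁-complement uX⊞Y)) X⊞Y∩N≡0 X⊞Y⊹N≡F
    where
    uX⊞Y = ⊞-closed X Y uX uY
    a = X ∩ ∁ Y
    b = ∁ X ∩ Y
    c = X ∩ Y
    d = ∁ X ∩ ∁ Y
    ua = ∩-closed _ _ uX (∁-closed uY)
    ub = ∩-closed _ _ (∁-closed uX) uY
    uc = ∩-closed _ _ uX uY
    ud = ∩-closed _ _ (∁-closed uX) (∁-closed uY)
    X⊞Y⊹N≡F : (a ⊹ b) ⊹ (c ⊹ d) ≡ fullSp
    X⊞Y⊹N≡F = begin
      (a ⊹ b) ⊹ (c ⊹ d)    ≡⟨ ⊹-interchange a b c d ⟩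
      (a ⊹ c) ⊹ (b ⊹ d)    ≡⟨ cong (_⊹ (b ⊹ d)) (⊹-comm a c) ⟩
      (c ⊹ a) ⊹ (b ⊹ d)    ≡⟨ cong₂ _⊹_ (split uX uY) (split (∁-closed uX) uY) ⟨
      X ⊹ ∁ X              ≡⟨ proj₂ (∁-complement uX) ⟩
      fullSp               ∎
    X⊞Y∩N≡0 : (a ⊹ b) ∩ (c ⊹ d) ≡ zeroSp
    X⊞Y∩N≡0 = ⊹-disjointˡ ua ub (⊹-closed _ _ uc ud)
      (⊹-disjointʳ ua uc ud
        (trans (∩-comm a c) (separated⇒disjoint uY (sub uc) (sub ua) ∩⊆ʳ ∩⊆ʳ))
        (separated⇒disjoint uX (sub ua) (sub ud) ∩⊆ˡ ∩⊆ˡ))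
      (⊹-disjointʳ ub uc ud
        (trans (∩-comm b c) (separated⇒disjoint uX (sub uc) (sub ub) ∩⊆ˡ ∩⊆ˡ))
        (separated⇒disjoint uY (sub ub) (sub ud) ∩⊆ʳ ∩⊆ʳ))

  ∁-zeroSp : ∁ zeroSp ≡ fullSp
  ∁-zeroSp = trans (sym (⊹-identityˡ (∁ zeroSp))) (proj₂ (∁-complement zeroSp∈U))

  ⊞-comm : ∀ X Y → U X → U Y → X ⊞ Y ≡ Y ⊞ X
  ⊞-comm X Y _ _ = trans (⊹-comm (X ∩ ∁ Y) (∁ X ∩ Y)) (cong₂ _⊹_ (∩-comm (∁ X) Y) (∩-comm X (∁ Y)))

  ⊞-identityʳ : ∀ X → U X → X ⊞ zeroSp ≡ X
  ⊞-identityʳ X uX = begin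
    (X ∩ ∁ zeroSp) ⊹ (∁ X ∩ zeroSp)   ≡⟨ cong₂ _⊹_ (trans (cong (X ∩_) ∁-zeroSp) (∩-identityʳ X))
                                                   (∩-zeroʳ (sub (∁-closed uX))) ⟩
    X ⊹ zeroSp                        ≡⟨ ⊹-identityʳ X ⟩
    X                                 ∎

  ⊞-self : ∀ X → U X → X ⊞ X ≡ zeroSp
  ⊞-self X uX = begin
    (X ∩ ∁ X) ⊹ (∁ X ∩ X)   ≡⟨ cong₂ _⊹_ (proj₁ (∁-complement uX))
                                         (trans (∩-comm (∁ X) X) (proj₁ (∁-complement uX))) ⟩
    zeroSp ⊹ zeroSp         ≡⟨ ⊹-identityʳ zeroSp ⟩
    zeroSp                  ∎

  ⊞-assoc : ∀ X Y Z → U X → U Y → U Z → (X ⊞ Y) ⊞ Z ≡ X ⊞ (Y ⊞ Z)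
  ⊞-assoc X Y Z uX uY uZ = trans expandˡ (sym expandʳ)
    where
    a = X ∩ (Y ∩ Z)
    b = X ∩ (∁ Y ∩ ∁ Z)
    c = ∁ X ∩ (Y ∩ ∁ Z)
    d = ∁ X ∩ (∁ Y ∩ Z)
    expandˡ : (X ⊞ Y) ⊞ Z ≡ (a ⊹ b) ⊹ (c ⊹ d)
    expandˡ = begin
      ((X ⊞ Y) ∩ ∁ Z) ⊹ (∁ (X ⊞ Y) ∩ Z)
        ≡⟨ cong (λ T → ((X ⊞ Y) ∩ ∁ Z) ⊹ (T ∩ Z)) (∁-⊞ uX uY) ⟩
      ((X ⊞ Y) ∩ ∁ Z) ⊹ (((X ∩ Y) ⊹ (∁ X ∩ ∁ Y)) ∩ Z)
        ≡⟨ cong₂ _⊹_ (∩-distribʳ-⊹ (X ∩ ∁ Y) (∁ X ∩ Y) (∁ Z) (∩-closed _ _ uX (∁-closed uY))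
                                   (∩-closed _ _ (∁-closed uX) uY) (∁-closed uZ))
                     (∩-distribʳ-⊹ (X ∩ Y) (∁ X ∩ ∁ Y) Z (∩-closed _ _ uX uY)
                                   (∩-closed _ _ (∁-closed uX) (∁-closed uY)) uZ) ⟩
      (((X ∩ ∁ Y) ∩ ∁ Z) ⊹ ((∁ X ∩ Y) ∩ ∁ Z)) ⊹ (((X ∩ Y) ∩ Z) ⊹ ((∁ X ∩ ∁ Y) ∩ Z))
        ≡⟨ cong₂ _⊹_ (cong₂ _⊹_ (∩-assoc X (∁ Y) (∁ Z)) (∩-assoc (∁ X) Y (∁ Z)))
                     (cong₂ _⊹_ (∩-assoc X Y Z) (∩-assoc (∁ X) (∁ Y) Z)) ⟩
      (b ⊹ c) ⊹ (a ⊹ d)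
        ≡⟨ ⊹-interchange b c a d ⟩
      (b ⊹ a) ⊹ (c ⊹ d)
        ≡⟨ cong (_⊹ (c ⊹ d)) (⊹-comm b a) ⟩
      (a ⊹ b) ⊹ (c ⊹ d) ∎
    expandʳ : X ⊞ (Y ⊞ Z) ≡ (a ⊹ b) ⊹ (c ⊹ d)
    expandʳ = begin
      (X ∩ ∁ (Y ⊞ Z)) ⊹ (∁ X ∩ (Y ⊞ Z))
        ≡⟨ cong (λ T → (X ∩ T) ⊹ (∁ X ∩ (Y ⊞ Z))) (∁-⊞ uY uZ) ⟩
      (X ∩ ((Y ∩ Z) ⊹ (∁ Y ∩ ∁ Z))) ⊹ (∁ X ∩ (Y ⊞ Z))
        ≡⟨ cong₂ _⊹_ (∩-distribˡ-⊹ X (Y ∩ Z) (∁ Y ∩ ∁ Z) uX (∩-closed _ _ uY uZ)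
                                  (∩-closed _ _ (∁-closed uY) (∁-closed uZ)))
                     (∩-distribˡ-⊹ (∁ X) (Y ∩ ∁ Z) (∁ Y ∩ Z) (∁-closed uX) (∩-closed _ _ uY (∁-closed uZ))
                                  (∩-closed _ _ (∁-closed uY) uZ)) ⟩
      (a ⊹ b) ⊹ (c ⊹ d) ∎

  ⊞-cancelʳ : ∀ X Y W → U X → U Y → U W → (X ⊞ W) ⊞ (Y ⊞ W) ≡ X ⊞ Y
  ⊞-cancelʳ X Y W uX uY uW = begin
    (X ⊞ W) ⊞ (Y ⊞ W)    ≡⟨ ⊞-assoc X W (Y ⊞ W) uX uW (⊞-closed Y W uY uW) ⟩
    X ⊞ (W ⊞ (Y ⊞ W))    ≡⟨ cong (λ T → X ⊞ (W ⊞ T)) (⊞-comm Y W uY uW) ⟩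
    X ⊞ (W ⊞ (W ⊞ Y))    ≡⟨ cong (X ⊞_) (⊞-assoc W W Y uW uW uY) ⟨
    X ⊞ ((W ⊞ W) ⊞ Y)    ≡⟨ cong (λ T → X ⊞ (T ⊞ Y)) (⊞-self W uW) ⟩
    X ⊞ (zeroSp ⊞ Y)     ≡⟨ cong (X ⊞_) (trans (⊞-comm zeroSp Y zeroSp∈U uY) (⊞-identityʳ Y uY)) ⟩
    X ⊞ Y                ∎

  ⊹≡∩⊹⊞ : ∀ {X Y} → U X → U Y → X ⊹ Y ≡ (X ∩ Y) ⊹ (X ⊞ Y)
  ⊹≡∩⊹⊞ {X} {Y} uX uY = begin
    X ⊹ Y                                    ≡⟨ cong₂ _⊹_ (split uX uY) (split uY uX) ⟩
    (c ⊹ a) ⊹ ((Y ∩ X) ⊹ (Y ∩ ∁ X))          ≡⟨ cong₂ (λ T T′ → (c ⊹ a) ⊹ (T ⊹ T′))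
                                                        (∩-comm Y X) (∩-comm Y (∁ X)) ⟩
    (c ⊹ a) ⊹ (c ⊹ b)                        ≡⟨ ⊹-interchange c a c b ⟩
    (c ⊹ c) ⊹ (a ⊹ b)                        ≡⟨ cong (_⊹ (a ⊹ b)) (⊹-idem (∩-isSubspace (sub uX) (sub uY))) ⟩
    c ⊹ (a ⊹ b)                              ∎
    where
    a = X ∩ ∁ Y
    b = ∁ X ∩ Y
    c = X ∩ Y

  ∩-disjoint-⊞ : ∀ {X Y} → U X → U Y → (X ∩ Y) ∩ (X ⊞ Y) ≡ zeroSp
  ∩-disjoint-⊞ {X} {Y} uX uY = ⊹-disjointʳ uc (∩-closed _ _ uX (∁-closed uY)) (∩-closed _ _ (∁-closed uX) uY)
    (separated⇒disjoint uY (sub uc) (∩-isSubspace (sub uX) (sub (∁-closed uY))) ∩⊆ʳ ∩⊆ʳ)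
    (separated⇒disjoint uX (sub uc) (∩-isSubspace (sub (∁-closed uX)) (sub uY)) ∩⊆ˡ ∩⊆ˡ)
    where
    uc = ∩-closed _ _ uX uY

  dim-⊹≡dim-∩+dim-⊞ : ∀ {X Y s i e} → U X → U Y → HasDim (X ⊹ Y) s → HasDim (X ∩ Y) i → HasDim (X ⊞ Y) e
                    → s ≡ i ℕ.+ e
  dim-⊹≡dim-∩+dim-⊞ uX uY s-dim i-dim e-dim =
    dim-⊹-disjoint (∩-isSubspace (sub uX) (sub uY)) (sub (⊞-closed _ _ uX uY)) (∩-disjoint-⊞ uX uY)
      i-dim e-dim (HasDim-subst (⊹≡∩⊹⊞ uX uY) s-dim)

  -- d(X,Y) = dim (X ⊞ Y), which ⊞-cancelʳ shows to be invariant under translation by W.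
  ⊞-isometry : ∀ X Y W → U X → U Y → U W → SameDist X Y (X ⊞ W) (Y ⊞ W)
  ⊞-isometry X Y W uX uY uW a b c d a-dim b-dim c-dim d-dim = begin
    a ∸ b             ≡⟨ cong (_∸ b) (dim-⊹≡dim-∩+dim-⊞ uX uY a-dim b-dim e-dim) ⟩
    b ℕ.+ e ∸ b       ≡⟨ ℕ.m+n∸m≡n b e ⟩
    e                 ≡⟨ ℕ.m+n∸m≡n d e ⟨
    d ℕ.+ e ∸ d       ≡⟨ cong (_∸ d) (dim-⊹≡dim-∩+dim-⊞ (⊞-closed X W uX uW) (⊞-closed Y W uY uW) c-dim d-dim
                                        (HasDim-subst (sym (⊞-cancelʳ X Y W uX uY uW)) e-dim)) ⟨
    c ∸ d             ∎
    where
    e = dim (sub (⊞-closed X Y uX uY))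
    e-dim = dim-spec (sub (⊞-closed X Y uX uY))

  linear-code : IsLinearCode U × ClosedUnderIntersection U × U fullSp
  linear-code =
      (zeroSp∈U , _⊞_ , ⊞-closed , ⊞-assoc , ⊞-comm , ⊞-identityʳ , ⊞-self , ⊞-isometry)
    , ∩-closed , fullSp∈U

theorem11 : (q : ℕ) (F : FiniteField q) (n : ℕ) → 1 ≤ n
    → (U : Sub.Family F {n}) → Sub.InProjSpace F U
    → (Sub.IsDistributiveSublattice F U × Sub.HasComplement F U)
      ⇔ (Sub.IsLinearCode F U × Sub.ClosedUnderIntersection F U × U (Sub.fullSp F))
theorem11 q F n _ U U-sub = mk⇔
  (λ (U-lattice , U-compl) → Complemented⇒LinearCode.linear-code F U U-sub U-lattice U-compl)
  (λ (U-code , ∩-closed , fullSp∈U) →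
     LinearCode⇒Complemented.complemented-distributive F U U-sub U-code ∩-closed fullSp∈U)
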